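{- For any finite sequence $\sigma$ of nonnegative integers, there exists a graph $G$ such that $\sigma$ is the sequence of Betti numbers of the complex of independent sets $I(G)$.
   Context: A graph is a finite simple graph (finite simplicial complex of dimension at most 1). An independent set is a nonempty set of vertices whose induced subgraph has no edges; $I(G)$ is the simplicial complex whose simplices are the independent sets of $G$. Homology is taken with coefficients in a fixed field.
   Formalization: The Betti numbers are the reduced Betti numbers β̃₀, β̃₁, … of I(G) rather than the ordinary ones, with β̃ᵢ = 0 for every i beyond the length of σ. Each condition added here is assumed in the paper as well or is needed for the statement above to hold. -}

module Defs where

open import Level using (Level; _⊔_)
open import Algebra.Bundles using (CommutativeRing)
open import Data.Nat as ℕ using (ℕ; zero; suc)
import Data.Bool as Bool
open import Data.Bool using (Bool; true; false; _∧_; not; if_then_else_)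
import Data.Fin as Fin
open import Data.Fin using (Fin; zero; suc; _≟_)
open import Data.Vec as Vec using (Vec; []; _∷_; removeAt)
open import Data.Vec.Properties using (≡-dec)
open import Data.List as List using (List; []; _∷_; _++_; filter; length)
open import Data.Product using (Σ; _×_; _,_)
open import Relation.Nullary using (¬_; does)
open import Relation.Unary using (Pred)
open import Relation.Binary.PropositionalEquality using (_≡_)

record Field (c ℓ : Level) : Set (Level.suc (c ⊔ ℓ)) where
  field
    commutativeRing : CommutativeRing c ℓ
  open CommutativeRing commutativeRing public
  field
    0≉1     : ¬ (0# ≈ 1#)
    inverse : ∀ x → ¬ (x ≈ 0#) → Σ Carrier (λ y → x * y ≈ 1#)

record Graph (n : ℕ) : Set where
  field
    adj     : Fin n → Fin n → Bool
    symm    : ∀ u v → adj u v ≡ adj v u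
    irrefl  : ∀ v → adj v v ≡ false

-- Strictly increasing vectors (= k-element subsets of Fin n), listed.

subsets : (n k : ℕ) → List (Vec (Fin n) k)
subsets n       zero    = [] ∷ []
subsets zero    (suc k) = []
subsets (suc n) (suc k) =
  List.map (λ v → zero ∷ Vec.map suc v) (subsets n k)
  ++ List.map (Vec.map suc) (subsets n (suc k))

module _ {n : ℕ} (G : Graph n) where
  open Graph G

  nonAdjAll : ∀ {k} → Fin n → Vec (Fin n) k → Bool
  nonAdjAll u []       = true
  nonAdjAll u (v ∷ vs) = not (adj u v) ∧ nonAdjAll u vs

  independent : ∀ {k} → Vec (Fin n) k → Bool
  independent []       = true
  independent (v ∷ vs) = nonAdjAll v vs ∧ independent vs

  -- Faces of I(G) with s vertices, as increasing vertex lists.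
  -- s = 0 gives the single empty face; including it yields the
  -- augmented chain complex, whose homology is reduced homology.
  faces : (s : ℕ) → List (Vec (Fin n) s)
  faces s = filter (λ σ → independent σ Bool.≟ true) (subsets n s)

  nFaces : ℕ → ℕ
  nFaces s = length (faces s)

module _ {c ℓ : Level} (F : Field c ℓ) where
  open Field F using (Carrier; _≈_; _+_; _*_; -_; 0#; 1#)

  ∑ : (m : ℕ) → (Fin m → Carrier) → Carrier
  ∑ zero    f = 0#
  ∑ (suc m) f = f zero + ∑ m (λ i → f (suc i))

  sgn : ℕ → Carrier
  sgn zero    = 1#
  sgn (suc j) = - sgn j

  LinIndepCols : ∀ {m n r} → (Fin m → Fin n → Carrier) → (Fin r → Fin n) → Set (c ⊔ ℓ)
  LinIndepCols {m} {n} {r} M col =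
    (a : Fin r → Carrier) →
    (∀ i → ∑ r (λ j → a j * M i (col j)) ≈ 0#) →
    ∀ j → a j ≈ 0#

  HasRank : ∀ {m n} → (Fin m → Fin n → Carrier) → ℕ → Set (c ⊔ ℓ)
  HasRank {m} {n} M r =
    Σ (Fin r → Fin n) (λ col → LinIndepCols M col) ×
    ((col : Fin (suc r) → Fin n) → ¬ LinIndepCols M col)

  module _ {n : ℕ} (G : Graph n) where

    ∂ : (k : ℕ) → Fin (nFaces G k) → Fin (nFaces G (suc k)) → Carrier
    ∂ k row col =
      ∑ (suc k) (λ j →
        if does (≡-dec Fin._≟_ (List.lookup (faces G k) row)
                               (removeAt (List.lookup (faces G (suc k)) col) j))
        then sgn (Fin.toℕ j) else 0#)

    -- β̃ᵢ(I(G); F) = b, where i ≥ 0 is the dimension; the i-chains are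
    -- faces with i+1 vertices, and
    --   β̃ᵢ = dim Cᵢ − rank ∂ᵢ − rank ∂ᵢ₊₁ .
    ReducedBetti : ℕ → ℕ → Set (c ⊔ ℓ)
    ReducedBetti i b =
      Σ ℕ λ r₁ → Σ ℕ λ r₂ →
        HasRank (∂ i) r₁ × HasRank (∂ (suc i)) r₂ ×
        (nFaces G (suc i) ≡ (b ℕ.+ r₁) ℕ.+ r₂)

entry : List ℕ → ℕ → ℕ
entry []       i       = 0
entry (x ∷ xs) zero    = x
entry (x ∷ xs) (suc i) = entry xs i

-- Adding to G a vertex adjacent to all others adds an isolated point to I(G): β̃₀ grows by one
-- and nothing else changes. Adding a disjoint edge instead suspends I(G): every β̃ᵢ moves up to
-- degree i + 1 and β̃₀ becomes 0. So a single vertex (all β̃ᵢ = 0) realises the empty sequence,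
-- and a realisation of σ, suspended and then given σ₀ universal vertices, realises σ₀ ∷ σ.
--
-- The Betti numbers are dim Cᵢ − rank ∂ᵢ − rank ∂ᵢ₊₁, so the work is to track ranks of boundary
-- matrices. They are certified by column bases indexed by faces: the first operation only adds
-- zero rows, the suspension makes ∂ block triangular with −∂ on the two cones and identities
-- below them, and the Steinitz exchange lemma turns a column basis into the rank.

module Submission where

open import Defs
open import Level using (Level; _⊔_)
open import Function using (_∘_)
open import Data.Nat as ℕ using (ℕ; zero; suc)
import Data.Nat.Properties as ℕₚ
open import Data.Nat.Tactic.RingSolver using (solve-∀)
open import Data.Fin as Fin using (Fin; zero; suc; toℕ; punchIn)
open import Data.Fin.Properties using (punchInᵢ≢i; suc-injective)
open import Data.Product using (Σ; ∃; _×_; _,_; proj₁; proj₂; map₂)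
open import Data.Sum using (_⊎_; inj₁; inj₂)
open import Data.Empty using (⊥; ⊥-elim)
import Data.Bool as Bool
open import Data.Bool using (Bool; true; false; if_then_else_; _∧_; not)
open import Relation.Nullary using (¬_; Dec; does; yes; no; ¬¬-excluded-middle)
open import Relation.Binary.Definitions using (DecidableEquality)
open import Relation.Binary.PropositionalEquality as ≡ using (_≡_; _≢_)
open import Data.Vec as Vec using (Vec; []; _∷_; removeAt)
import Data.Vec.Properties as Vec
open import Data.Vec.Properties using (≡-dec; ∷-injective; ∷-injectiveˡ)
open import Data.List as List using (List; []; _∷_; _++_; length; lookup; filter)
open import Data.List.Properties using (length-map; length-++; map-++; map-∘; filter-++)
open import Data.List.Relation.Binary.Subset.Propositional.Properties using () renaming (map⁺ to ⊆-map⁺)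
open import Data.List.Membership.Propositional using (_∈_)
open import Data.List.Membership.Propositional.Properties
  using (∈-lookup; ∈-map⁺; ∈-map⁻; ∈-++⁺ˡ; ∈-++⁺ʳ; ∈-++⁻; ∈-filter⁺; ∈-filter⁻; ∈-tabulate⁻)
open import Data.List.Relation.Binary.Subset.Propositional using (_⊆_)
open import Data.List.Relation.Unary.Any using (here; there; index)
open import Data.List.Relation.Unary.Any.Properties using (lookup-index)
import Data.List.Relation.Unary.All as All
open import Data.List.Relation.Unary.AllPairs using ([]; _∷_)
open import Data.List.Relation.Unary.Unique.Propositional using (Unique)
import Data.List.Relation.Unary.Unique.Propositional.Properties as Unique

lookup-injective : ∀ {a} {A : Set a} {xs : List A} → Unique xs → ∀ {i j} → lookup xs i ≡ lookup xs j → i ≡ j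
lookup-injective (_     ∷ _)     {zero}  {zero}  _   = ≡.refl
lookup-injective (x∉xs ∷ _)     {zero}  {suc j} x≡xⱼ = ⊥-elim (All.lookup x∉xs (∈-lookup j) x≡xⱼ)
lookup-injective (x∉xs ∷ _)     {suc i} {zero}  xᵢ≡x = ⊥-elim (All.lookup x∉xs (∈-lookup i) (≡.sym xᵢ≡x))
lookup-injective (_     ∷ uniq) {suc i} {suc j} xᵢ≡xⱼ = ≡.cong suc (lookup-injective uniq xᵢ≡xⱼ)

removeAt-map : ∀ {a b} {A : Set a} {B : Set b} {k} (f : A → B) (xs : Vec A (suc k)) j →
               removeAt (Vec.map f xs) j ≡ Vec.map f (removeAt xs j)
removeAt-map f (x ∷ xs)     zero    = ≡.refl
removeAt-map f (x ∷ y ∷ xs) (suc j) = ≡.cong (f x ∷_) (removeAt-map f (y ∷ xs) j)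

map-injective : ∀ {a b} {A : Set a} {B : Set b} {f : A → B} → (∀ {x y} → f x ≡ f y → x ≡ y) →
                ∀ {k} {xs ys : Vec A k} → Vec.map f xs ≡ Vec.map f ys → xs ≡ ys
map-injective f-injective {xs = []}     {[]}     _   = ≡.refl
map-injective f-injective {xs = x ∷ xs} {y ∷ ys} eq with ∷-injective eq
... | fx≡fy , fxs≡fys = ≡.cong₂ _∷_ (f-injective fx≡fy) (map-injective f-injective fxs≡fys)

module LinearAlgebra {c ℓ : Level} (F : Field c ℓ) where

  open Field F hiding (zero)
  open import Algebra.Properties.Ring ring
    using (-‿distribˡ-*; -‿+-comm; -0#≈0#; x[y-z]≈xy-xz; [y-z]x≈yx-zx)
  open import Algebra.Properties.Semiring.Sum semiring
    using (sum; sum-cong-≋; sum-cong-≗; sum-replicate-zero; sum-remove; ∑-distrib-+; ∑-comm; *-distribˡ-sum; *-distribʳ-sum)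
  open import Algebra.Properties.CommutativeSemigroup +-commutativeSemigroup using () renaming (interchange to +-interchange)
  open import Relation.Binary.Reasoning.Setoid setoid

  ∑≡sum : ∀ n (f : Fin n → Carrier) → ∑ F n f ≡ sum f
  ∑≡sum zero    f = ≡.refl
  ∑≡sum (suc n) f = ≡.cong (f zero +_) (∑≡sum n (f ∘ suc))

  ∑-cong : ∀ n {f g : Fin n → Carrier} → (∀ i → f i ≈ g i) → ∑ F n f ≈ ∑ F n g
  ∑-cong zero    f≈g = refl
  ∑-cong (suc n) f≈g = +-cong (f≈g zero) (∑-cong n (f≈g ∘ suc))

  sum-zero : ∀ {n} {f : Fin n → Carrier} → (∀ i → f i ≈ 0#) → sum f ≈ 0#
  sum-zero {n} f≈0 = trans (sum-cong-≋ f≈0) (sum-replicate-zero n)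

  sum-neg : ∀ {n} (f : Fin n → Carrier) → sum (λ i → - f i) ≈ - sum f
  sum-neg {zero}  f = sym -0#≈0#
  sum-neg {suc n} f = trans (+-congˡ (sum-neg (f ∘ suc))) (-‿+-comm (f zero) _)

  sum-pick : ∀ {n} (i : Fin n) (f : Fin n → Carrier) → (∀ j → j ≢ i → f j ≈ 0#) → sum f ≈ f i
  sum-pick {suc n} i f rest≈0 = begin
    sum f                               ≈⟨ sum-remove f ⟩
    f i + sum (f ∘ punchIn i)           ≈⟨ +-congˡ (sum-zero (λ j → rest≈0 _ (punchInᵢ≢i i j))) ⟩
    f i + 0#                            ≈⟨ +-identityʳ _ ⟩
    f i                                 ∎

  module _ {a} {A : Set a} (_≟_ : DecidableEquality A) where

    δ : A → A → Carrier
    δ x y = if does (x ≟ y) then 1# else 0#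

    δ-refl : ∀ x → δ x x ≈ 1#
    δ-refl x with x ≟ x
    ... | yes _  = refl
    ... | no x≢x = ⊥-elim (x≢x ≡.refl)

    δ-≢ : ∀ {x y} → x ≢ y → δ x y ≈ 0#
    δ-≢ {x} {y} x≢y with x ≟ y
    ... | yes x≡y = ⊥-elim (x≢y x≡y)
    ... | no _    = refl

    sum-δ : ∀ {n} (g : Fin n → A) (f : Fin n → Carrier) → (∀ {i j} → g i ≡ g j → i ≡ j) →
            ∀ i → sum (λ j → δ (g i) (g j) * f j) ≈ f i
    sum-δ g f g-injective i = begin
      sum (λ j → δ (g i) (g j) * f j)  ≈⟨ sum-pick i _ (λ j j≢i → trans (*-congʳ (δ-≢ (j≢i ∘ ≡.sym ∘ g-injective))) (zeroˡ _)) ⟩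
      δ (g i) (g i) * f i              ≈⟨ trans (*-congʳ (δ-refl (g i))) (*-identityˡ _) ⟩
      f i                              ∎

  -- Equality in F is not decidable, so this case split is classical; it is only used to prove ⊥.
  all-zero-or-nonzero : ∀ {n} (f : Fin n → Carrier) → ¬ ¬ ((∀ i → f i ≈ 0#) ⊎ ∃ λ i → f i ≉ 0#)
  all-zero-or-nonzero {zero}  f k = k (inj₁ λ ())
  all-zero-or-nonzero {suc n} f k = ¬¬-excluded-middle λ
    { (no f₀≉0)  → k (inj₂ (zero , f₀≉0))
    ; (yes f₀≈0) → all-zero-or-nonzero (f ∘ suc) λ
        { (inj₁ rest≈0)      → k (inj₁ λ { zero → f₀≈0 ; (suc i) → rest≈0 i })
        ; (inj₂ (i , fᵢ≉0)) → k (inj₂ (suc i , fᵢ≉0)) } }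

  infix 8 _·_

  _·_ : ∀ {r m} → (Fin r → Carrier) → (Fin r → Fin m → Carrier) → Fin m → Carrier
  (a · v) i = sum (λ k → a k * v k i)

  Independent : ∀ {r m} → (Fin r → Fin m → Carrier) → Set (c ⊔ ℓ)
  Independent v = ∀ a → (∀ i → (a · v) i ≈ 0#) → ∀ k → a k ≈ 0#

  independent⇒nonzero : ∀ {r m} {v : Fin r → Fin m → Carrier} → Independent v → ∀ k → ¬ (∀ i → v k i ≈ 0#)
  independent⇒nonzero {v = v} v-independent k vₖ≈0 =
    0≉1 (sym (trans (sym (δ-refl Fin._≟_ k)) (v-independent (δ Fin._≟_ k) δₖ·v≈0 k)))
    where
    δₖ·v≈0 : ∀ i → (δ Fin._≟_ k · v) i ≈ 0#
    δₖ·v≈0 i = trans (sum-δ Fin._≟_ (λ j → j) (λ j → v j i) (λ i≡j → i≡j) k) (vₖ≈0 i)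

  independent-shear : ∀ {r m} {v : Fin (suc r) → Fin m → Carrier} (d : Fin r → Carrier) → Independent v →
                      Independent (λ j i → v (suc j) i - d j * v zero i)
  independent-shear {r} {v = v} d v-independent b b·u≈0 j = v-independent a a·v≈0 (suc j)
    where
    a : Fin (suc r) → Carrier
    a zero    = - sum (λ j → b j * d j)
    a (suc j) = b j

    a·v≈0 : ∀ i → (a · v) i ≈ 0#
    a·v≈0 i = begin
      - sum (λ j → b j * d j) * v zero i + sum (λ j → b j * v (suc j) i)
        ≈⟨ +-comm _ _ ⟩
      sum (λ j → b j * v (suc j) i) + - sum (λ j → b j * d j) * v zero i
        ≈⟨ +-congˡ (sym (-‿distribˡ-* _ _)) ⟩
      sum (λ j → b j * v (suc j) i) + - (sum (λ j → b j * d j) * v zero i)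
        ≈⟨ +-congˡ (-‿cong (*-distribʳ-sum (v zero i) (λ j → b j * d j))) ⟩
      sum (λ j → b j * v (suc j) i) + - sum (λ j → (b j * d j) * v zero i)
        ≈⟨ +-congˡ (sym (sum-neg (λ j → (b j * d j) * v zero i))) ⟩
      sum (λ j → b j * v (suc j) i) + sum (λ j → - ((b j * d j) * v zero i))
        ≈⟨ sym (∑-distrib-+ (λ j → b j * v (suc j) i) (λ j → - ((b j * d j) * v zero i))) ⟩
      sum (λ j → b j * v (suc j) i + - ((b j * d j) * v zero i))
        ≈⟨ sum-cong-≋ (λ j → trans (+-congˡ (-‿cong (*-assoc (b j) (d j) (v zero i))))
                                   (sym (x[y-z]≈xy-xz (b j) (v (suc j) i) (d j * v zero i)))) ⟩
      sum (λ j → b j * (v (suc j) i - d j * v zero i))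
        ≈⟨ b·u≈0 i ⟩
      0# ∎

  eliminate-pivot : ∀ {r m} (w : Fin (suc r) → Fin m → Carrier) (a b : Fin (suc r) → Carrier) d p →
                    a p ≈ d * b p →
                    ∀ i → (a · w) i - d * (b · w) i
                          ≈ ((λ l → a (punchIn p l) - d * b (punchIn p l)) · (w ∘ punchIn p)) i
  eliminate-pivot {r} w a b d p aₚ≈dbₚ i = begin
    (a · w) i - d * (b · w) i
      ≈⟨ +-congˡ (-‿cong (*-distribˡ-sum d (λ l → b l * w l i))) ⟩
    (a · w) i - sum (λ l → d * (b l * w l i))
      ≈⟨ +-congˡ (sym (sum-neg (λ l → d * (b l * w l i)))) ⟩
    (a · w) i + sum (λ l → - (d * (b l * w l i)))
      ≈⟨ sym (∑-distrib-+ (λ l → a l * w l i) (λ l → - (d * (b l * w l i)))) ⟩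
    sum (λ l → a l * w l i + - (d * (b l * w l i)))
      ≈⟨ sum-cong-≋ (λ l → sym (trans ([y-z]x≈yx-zx (w l i) (a l) (d * b l)) (+-congˡ (-‿cong (*-assoc d (b l) (w l i)))))) ⟩
    sum (λ l → e l * w l i)
      ≈⟨ sum-remove (λ l → e l * w l i) ⟩
    e p * w p i + ((e ∘ punchIn p) · (w ∘ punchIn p)) i
      ≈⟨ +-congʳ (trans (*-congʳ eₚ≈0) (zeroˡ _)) ⟩
    0# + ((e ∘ punchIn p) · (w ∘ punchIn p)) i
      ≈⟨ +-identityˡ _ ⟩
    ((e ∘ punchIn p) · (w ∘ punchIn p)) i ∎
    where
    e : Fin (suc r) → Carrier
    e l = a l - d * b l
    eₚ≈0 : e p ≈ 0#
    eₚ≈0 = trans (+-congʳ aₚ≈dbₚ) (-‿inverseʳ _)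

  -- The Steinitz exchange lemma, by elimination on a nonzero coefficient.
  combinations-dependent : ∀ r {m} (w : Fin r → Fin m → Carrier) (v : Fin (suc r) → Fin m → Carrier)
                           (A : Fin (suc r) → Fin r → Carrier) →
                           (∀ k i → v k i ≈ (A k · w) i) → ¬ Independent v
  combinations-dependent zero    w v A v≈Aw v-independent =
    independent⇒nonzero {v = v} v-independent zero (v≈Aw zero)
  combinations-dependent (suc r) {m} w v A v≈Aw v-independent = all-zero-or-nonzero (A zero) λ
    { (inj₁ A₀≈0)        → independent⇒nonzero {v = v} v-independent zero λ i →
                             trans (v≈Aw zero i) (sum-zero {f = λ l → A zero l * w l i} (λ l → trans (*-congʳ (A₀≈0 l)) (zeroˡ _)))
    ; (inj₂ (p , A₀ₚ≉0)) → eliminate p A₀ₚ≉0 }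
    where
    eliminate : ∀ p → A zero p ≉ 0# → ⊥
    eliminate p A₀ₚ≉0 =
      combinations-dependent r (w ∘ punchIn p) u A′ u≈A′w (independent-shear {v = v} d v-independent)
      where
      A₀ₚ⁻¹ : Carrier
      A₀ₚ⁻¹ = proj₁ (inverse _ A₀ₚ≉0)
      d : Fin (suc r) → Carrier
      d j = A (suc j) p * A₀ₚ⁻¹
      u : Fin (suc r) → Fin m → Carrier
      u j i = v (suc j) i - d j * v zero i
      A′ : Fin (suc r) → Fin r → Carrier
      A′ j l = A (suc j) (punchIn p l) - d j * A zero (punchIn p l)
      pivot-ratio : ∀ j → A (suc j) p ≈ d j * A zero p
      pivot-ratio j = sym (begin
        A (suc j) p * A₀ₚ⁻¹ * A zero p    ≈⟨ *-assoc _ _ _ ⟩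
        A (suc j) p * (A₀ₚ⁻¹ * A zero p)  ≈⟨ *-congˡ (trans (*-comm _ _) (proj₂ (inverse _ A₀ₚ≉0))) ⟩
        A (suc j) p * 1#                  ≈⟨ *-identityʳ _ ⟩
        A (suc j) p                       ∎)
      u≈A′w : ∀ j i → u j i ≈ (A′ j · (w ∘ punchIn p)) i
      u≈A′w j i = trans (+-cong (v≈Aw (suc j) i) (-‿cong (*-congˡ (v≈Aw zero i))))
                        (eliminate-pivot w (A (suc j)) (A zero) (d j) p (pivot-ratio j) i)

  LinIndepCols-cong : ∀ {m n r} {M N : Fin m → Fin n → Carrier} → (∀ i j → M i j ≈ N i j) →
                      (col : Fin r → Fin n) → LinIndepCols F M col → LinIndepCols F N col
  LinIndepCols-cong {r = r} M≈N col M-independent a a·N≈0 =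
    M-independent a (λ i → trans (∑-cong r (λ j → *-congˡ (M≈N i (col j)))) (a·N≈0 i))

  HasRank-cong : ∀ {m n} {M N : Fin m → Fin n → Carrier} {r} → (∀ i j → M i j ≈ N i j) →
                 HasRank F M r → HasRank F N r
  HasRank-cong M≈N ((col , M-independent) , M-dependent) =
    (col , LinIndepCols-cong M≈N col M-independent) ,
    λ col′ → M-dependent col′ ∘ LinIndepCols-cong (λ i j → sym (M≈N i j)) col′

  sumₗ : ∀ {a} {A : Set a} → List A → (A → Carrier) → Carrier
  sumₗ []       f = 0#
  sumₗ (x ∷ xs) f = f x + sumₗ xs f

  infix 5 sumₗ
  syntax sumₗ xs (λ x → e) = ∑[ x ∈ xs ] e

  module _ {a} {A : Set a} where

    sumₗ-cong : ∀ (xs : List A) {f g : A → Carrier} → (∀ {x} → x ∈ xs → f x ≈ g x) → sumₗ xs f ≈ sumₗ xs g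
    sumₗ-cong []       f≈g = refl
    sumₗ-cong (x ∷ xs) f≈g = +-cong (f≈g (here ≡.refl)) (sumₗ-cong xs (f≈g ∘ there))

    sumₗ-zero : ∀ (xs : List A) {f : A → Carrier} → (∀ {x} → x ∈ xs → f x ≈ 0#) → sumₗ xs f ≈ 0#
    sumₗ-zero []       f≈0 = refl
    sumₗ-zero (x ∷ xs) f≈0 = trans (+-cong (f≈0 (here ≡.refl)) (sumₗ-zero xs (f≈0 ∘ there))) (+-identityˡ 0#)

    sumₗ-++ : ∀ (xs ys : List A) (f : A → Carrier) → sumₗ (xs ++ ys) f ≈ sumₗ xs f + sumₗ ys f
    sumₗ-++ []       ys f = sym (+-identityˡ _)
    sumₗ-++ (x ∷ xs) ys f = trans (+-congˡ (sumₗ-++ xs ys f)) (sym (+-assoc _ _ _))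

    sumₗ-map : ∀ {b} {B : Set b} (h : A → B) (xs : List A) (f : B → Carrier) → sumₗ (List.map h xs) f ≡ sumₗ xs (f ∘ h)
    sumₗ-map h []       f = ≡.refl
    sumₗ-map h (x ∷ xs) f = ≡.cong (f (h x) +_) (sumₗ-map h xs f)

    sumₗ-+ : ∀ (xs : List A) (f g : A → Carrier) → ∑[ x ∈ xs ] (f x + g x) ≈ sumₗ xs f + sumₗ xs g
    sumₗ-+ []       f g = sym (+-identityˡ 0#)
    sumₗ-+ (x ∷ xs) f g = trans (+-congˡ (sumₗ-+ xs f g)) (+-interchange (f x) (g x) _ _)

    sumₗ-neg : ∀ (xs : List A) (f : A → Carrier) → sumₗ xs (λ x → - f x) ≈ - sumₗ xs f
    sumₗ-neg []       f = sym -0#≈0#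
    sumₗ-neg (x ∷ xs) f = trans (+-congˡ (sumₗ-neg xs f)) (-‿+-comm _ _)

    sumₗ-*ʳ : ∀ (xs : List A) (f : A → Carrier) y → sumₗ xs (λ x → f x * y) ≈ sumₗ xs f * y
    sumₗ-*ʳ []       f y = sym (zeroˡ y)
    sumₗ-*ʳ (x ∷ xs) f y = trans (+-congˡ (sumₗ-*ʳ xs f y)) (sym (distribʳ y _ _))

    sumₗ-lookup : ∀ (xs : List A) (f : A → Carrier) → sumₗ xs f ≡ sum (f ∘ lookup xs)
    sumₗ-lookup []       f = ≡.refl
    sumₗ-lookup (x ∷ xs) f = ≡.cong (f x +_) (sumₗ-lookup xs f)

    sumₗ-sum : ∀ (xs : List A) {n} (g : A → Fin n → Carrier) →
               ∑[ x ∈ xs ] sum (g x) ≈ sum (λ i → ∑[ x ∈ xs ] g x i)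
    sumₗ-sum xs g = begin
      ∑[ x ∈ xs ] sum (g x)                      ≡⟨ sumₗ-lookup xs _ ⟩
      sum (λ k → sum (g (lookup xs k)))           ≈⟨ ∑-comm (λ k i → g (lookup xs k) i) ⟩
      sum (λ i → sum (λ k → g (lookup xs k) i))   ≡⟨ sum-cong-≗ (λ i → ≡.sym (sumₗ-lookup xs (λ x → g x i))) ⟩
      sum (λ i → ∑[ x ∈ xs ] g x i)              ∎

    sumₗ-tabulate : ∀ {n} (g : Fin n → A) (f : A → Carrier) → sumₗ (List.tabulate g) f ≡ sum (f ∘ g)
    sumₗ-tabulate {zero}  g f = ≡.refl
    sumₗ-tabulate {suc n} g f = ≡.cong (f (g zero) +_) (sumₗ-tabulate (g ∘ suc) f)

  sumₗ-δ : ∀ {a} {A : Set a} (_≟_ : DecidableEquality A) {xs : List A} → Unique xs →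
           ∀ (f : A → Carrier) {x} → x ∈ xs → ∑[ y ∈ xs ] f y * δ _≟_ x y ≈ f x
  sumₗ-δ _≟_ {y ∷ ys} (y∉ys ∷ _) f (here ≡.refl) = begin
    f y * δ _≟_ y y + (∑[ z ∈ ys ] f z * δ _≟_ y z)  ≈⟨ +-cong (trans (*-congˡ (δ-refl _≟_ y)) (*-identityʳ _))
                                                            (sumₗ-zero ys (λ z∈ → trans (*-congˡ (δ-≢ _≟_ (All.lookup y∉ys z∈))) (zeroʳ _))) ⟩
    f y + 0#                                       ≈⟨ +-identityʳ _ ⟩
    f y                                            ∎
  sumₗ-δ _≟_ {y ∷ ys} (y∉ys ∷ ys-unique) f (there x∈) = begin
    f y * δ _≟_ _ y + (∑[ z ∈ ys ] f z * δ _≟_ _ z)  ≈⟨ +-cong (trans (*-congˡ (δ-≢ _≟_ (All.lookup y∉ys x∈ ∘ ≡.sym))) (zeroʳ _))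
                                                            (sumₗ-δ _≟_ ys-unique f x∈) ⟩
    0# + f _                                       ≈⟨ +-identityˡ _ ⟩
    f _                                            ∎

  combine : ∀ {X Y : Set} → (X → Y → Carrier) → X → List (Carrier × Y) → Carrier
  combine D x L = ∑[ p ∈ L ] proj₁ p * D x (proj₂ p)

  module _ {X Y : Set} (D : X → Y → Carrier) (rows : List X) where

    IndependentColumns : List Y → Set (c ⊔ ℓ)
    IndependentColumns ys = ∀ (a : Y → Carrier) → (∀ {x} → x ∈ rows → ∑[ y ∈ ys ] a y * D x y ≈ 0#) →
                            ∀ {y} → y ∈ ys → a y ≈ 0#

    InSpan : List Y → Y → Set (c ⊔ ℓ)
    InSpan ys y = Σ (List (Carrier × Y)) λ L → (∀ {p} → p ∈ L → proj₂ p ∈ ys) × (∀ {x} → x ∈ rows → D x y ≈ combine D x L)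

    -- Rows and columns are named by faces rather than by positions in the face lists, so that
    -- bases survive the list rearrangements of the graph constructions.
    record ColumnBasis (cols : List Y) (r : ℕ) : Set (c ⊔ ℓ) where
      field
        basis             : List Y
        length-basis      : length basis ≡ r
        basis⊆cols        : basis ⊆ cols
        basis-unique      : Unique basis
        basis-independent : IndependentColumns basis
        basis-spans       : ∀ {y} → y ∈ cols → InSpan basis y

  module _ {X Y : Set} (_≟_ : DecidableEquality Y) {D : X → Y → Carrier} {rows : List X} {cols : List Y} where

    columnBasis⇒hasRank : ∀ {r} → ColumnBasis D rows cols r →
                          HasRank F (λ i j → D (lookup rows i) (lookup cols j)) r
    columnBasis⇒hasRank B = ≡.subst (HasRank F M) length-basis ((position , independent-at-positions) , dependent)
      where
      open ColumnBasis B
      M : Fin (length rows) → Fin (length cols) → Carrier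
      M i j = D (lookup rows i) (lookup cols j)
      b : Fin (length basis) → Y
      b = lookup basis
      b-injective : ∀ {i j} → b i ≡ b j → i ≡ j
      b-injective = lookup-injective basis-unique
      position : Fin (length basis) → Fin (length cols)
      position l = index (basis⊆cols (∈-lookup l))
      D≡M : ∀ {x} (x∈rows : x ∈ rows) l → D x (b l) ≡ M (index x∈rows) (position l)
      D≡M x∈rows l = ≡.cong₂ D (lookup-index x∈rows) (lookup-index (basis⊆cols (∈-lookup l)))

      independent-at-positions : LinIndepCols F M position
      independent-at-positions a a·M≈0 l = begin
        a l       ≈⟨ sym (sum-δ _≟_ b a b-injective l) ⟩
        a′ (b l)  ≈⟨ basis-independent a′ a′·D≈0 (∈-lookup l) ⟩
        0#        ∎
        where
        a′ : Y → Carrier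
        a′ y = sum (λ j → δ _≟_ y (b j) * a j)
        a′·D≈0 : ∀ {x} → x ∈ rows → ∑[ y ∈ basis ] a′ y * D x y ≈ 0#
        a′·D≈0 {x} x∈rows = begin
          ∑[ y ∈ basis ] a′ y * D x y                         ≡⟨ sumₗ-lookup basis (λ y → a′ y * D x y) ⟩
          sum (λ l → a′ (b l) * D x (b l))                    ≈⟨ sum-cong-≋ (λ l → *-cong (sum-δ _≟_ b a b-injective l) (reflexive (D≡M x∈rows l))) ⟩
          sum (λ l → a l * M (index x∈rows) (position l))     ≡⟨ ≡.sym (∑≡sum _ (λ l → a l * M (index x∈rows) (position l))) ⟩
          ∑ F (length basis) (λ l → a l * M (index x∈rows) (position l)) ≈⟨ a·M≈0 (index x∈rows) ⟩
          0#                                                  ∎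

      dependent : (col : Fin (suc (length basis)) → Fin (length cols)) → ¬ LinIndepCols F M col
      dependent col col-independent = combinations-dependent (length basis) w v A v≈Aw v-independent
        where
        w : Fin (length basis) → Fin (length rows) → Carrier
        w l i = M i (position l)
        v : Fin (suc (length basis)) → Fin (length rows) → Carrier
        v k i = M i (col k)
        v-independent : Independent v
        v-independent a a·v≈0 = col-independent a (λ i → trans (reflexive (∑≡sum _ (λ k → a k * v k i))) (a·v≈0 i))
        L : Fin (suc (length basis)) → List (Carrier × Y)
        L k = proj₁ (basis-spans (∈-lookup (col k)))
        δᵇ : Y → Fin (length basis) → Carrier
        δᵇ y l = δ _≟_ y (b l)
        A : Fin (suc (length basis)) → Fin (length basis) → Carrier
        A k l = ∑[ p ∈ L k ] proj₁ p * δᵇ (proj₂ p) l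
        expand : ∀ (g : Y → Carrier) {y} → y ∈ basis → g y ≈ sum (λ l → δᵇ y l * g (b l))
        expand g y∈basis = ≡.subst (λ y → g y ≈ sum (λ l → δᵇ y l * g (b l)))
                                   (≡.sym (lookup-index y∈basis)) (sym (sum-δ _≟_ b (g ∘ b) b-injective (index y∈basis)))
        v≈Aw : ∀ k i → v k i ≈ (A k · w) i
        v≈Aw k i = begin
          D x (lookup cols (col k))
            ≈⟨ proj₂ (proj₂ (basis-spans (∈-lookup (col k)))) (∈-lookup i) ⟩
          ∑[ p ∈ L k ] proj₁ p * D x (proj₂ p)
            ≈⟨ sumₗ-cong (L k) (λ p∈L → *-congˡ (expand (D x) (proj₁ (proj₂ (basis-spans (∈-lookup (col k)))) p∈L))) ⟩
          ∑[ p ∈ L k ] proj₁ p * sum (λ l → δᵇ (proj₂ p) l * D x (b l))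
            ≈⟨ sumₗ-cong (L k) (λ {p} _ → distribute p) ⟩
          ∑[ p ∈ L k ] sum (λ l → proj₁ p * δᵇ (proj₂ p) l * D x (b l))
            ≈⟨ sumₗ-sum (L k) (λ p l → proj₁ p * δᵇ (proj₂ p) l * D x (b l)) ⟩
          sum (λ l → ∑[ p ∈ L k ] proj₁ p * δᵇ (proj₂ p) l * D x (b l))
            ≈⟨ sum-cong-≋ (λ l → sumₗ-*ʳ (L k) (λ p → proj₁ p * δᵇ (proj₂ p) l) (D x (b l))) ⟩
          sum (λ l → A k l * D x (b l))
            ≡⟨ sum-cong-≗ (λ l → ≡.cong (λ y → A k l * D x y) (lookup-index (basis⊆cols (∈-lookup l)))) ⟩
          (A k · w) i ∎
          where
          x : X
          x = lookup rows i
          distribute : ∀ p → proj₁ p * sum (λ l → δᵇ (proj₂ p) l * D x (b l)) ≈ sum (λ l → proj₁ p * δᵇ (proj₂ p) l * D x (b l))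
          distribute (a , y) = trans (*-distribˡ-sum a (λ l → δᵇ y l * D x (b l))) (sum-cong-≋ (λ l → sym (*-assoc a (δᵇ y l) (D x (b l)))))

  module _ {X Y : Set} {D : X → Y → Carrier} {rows : List X} where

    InSpan-member : ∀ {ys y} → y ∈ ys → InSpan D rows ys y
    InSpan-member {y = y} y∈ys = (1# , y) ∷ [] , (λ { (here ≡.refl) → y∈ys }) , λ _ → sym (trans (+-identityʳ _) (*-identityˡ _))

    ColumnBasis-empty : ColumnBasis D rows [] 0
    ColumnBasis-empty = record
      { basis = [] ; length-basis = ≡.refl ; basis⊆cols = λ () ; basis-unique = []
      ; basis-independent = λ _ _ () ; basis-spans = λ () }

  module _ {X Y X′ Y′ : Set} {D : X → Y → Carrier} {D′ : X′ → Y′ → Carrier}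
           (fx : X → X′) (fy : Y → Y′) (fy-injective : ∀ {y y′} → fy y ≡ fy y′ → y ≡ y′)
           (D′∘f≈D : ∀ x y → D′ (fx x) (fy y) ≈ D x y)
           {zeroRows : List X′} (zeroRows≈0 : ∀ {z} → z ∈ zeroRows → ∀ y → D′ z (fy y) ≈ 0#) where

    ColumnBasis-embed : ∀ {rows cols r} → ColumnBasis D rows cols r →
                        ColumnBasis D′ (zeroRows ++ List.map fx rows) (List.map fy cols) r
    ColumnBasis-embed {rows} {cols} B = record
      { basis             = List.map fy basis
      ; length-basis      = ≡.trans (length-map fy basis) length-basis
      ; basis⊆cols        = ⊆-map⁺ fy basis⊆cols
      ; basis-unique      = Unique.map⁺ fy-injective basis-unique
      ; basis-independent = independent′
      ; basis-spans       = spans′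
      }
      where
      open ColumnBasis B
      independent′ : IndependentColumns D′ (zeroRows ++ List.map fx rows) (List.map fy basis)
      independent′ a a·D′≈0 y′∈ with ∈-map⁻ fy y′∈
      ... | y , y∈ , ≡.refl = basis-independent (a ∘ fy) a·D≈0 y∈
        where
        a·D≈0 : ∀ {x} → x ∈ rows → ∑[ y ∈ basis ] a (fy y) * D x y ≈ 0#
        a·D≈0 {x} x∈ = begin
          ∑[ y ∈ basis ] a (fy y) * D x y                   ≈⟨ sumₗ-cong basis (λ {y} _ → *-congˡ (sym (D′∘f≈D x y))) ⟩
          ∑[ y ∈ basis ] a (fy y) * D′ (fx x) (fy y)        ≡⟨ ≡.sym (sumₗ-map fy basis (λ y′ → a y′ * D′ (fx x) y′)) ⟩
          ∑[ y′ ∈ List.map fy basis ] a y′ * D′ (fx x) y′   ≈⟨ a·D′≈0 (∈-++⁺ʳ zeroRows (∈-map⁺ fx x∈)) ⟩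
          0#                                                ∎
      spans′ : ∀ {y′} → y′ ∈ List.map fy cols → InSpan D′ (zeroRows ++ List.map fx rows) (List.map fy basis) y′
      spans′ y′∈ with ∈-map⁻ fy y′∈
      ... | y , y∈ , ≡.refl with basis-spans y∈
      ...   | L , L⊆basis , D≈L = List.map (map₂ fy) L , L′⊆ , D′≈L′
        where
        L′⊆ : ∀ {p} → p ∈ List.map (map₂ fy) L → proj₂ p ∈ List.map fy basis
        L′⊆ p∈ with ∈-map⁻ (map₂ fy) p∈
        ... | _ , q∈ , ≡.refl = ∈-map⁺ fy (L⊆basis q∈)
        combine-map : ∀ x′ → combine D′ x′ (List.map (map₂ fy) L) ≡ ∑[ p ∈ L ] proj₁ p * D′ x′ (fy (proj₂ p))
        combine-map x′ = sumₗ-map (map₂ fy) L (λ p → proj₁ p * D′ x′ (proj₂ p))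
        D′≈L′ : ∀ {x′} → x′ ∈ zeroRows ++ List.map fx rows → D′ x′ (fy y) ≈ combine D′ x′ (List.map (map₂ fy) L)
        D′≈L′ {x′} x′∈ with ∈-++⁻ zeroRows x′∈
        ... | inj₁ z∈ = begin
          D′ x′ (fy y)                               ≈⟨ zeroRows≈0 z∈ y ⟩
          0#                                         ≈⟨ sym (sumₗ-zero L (λ {p} _ → trans (*-congˡ (zeroRows≈0 z∈ (proj₂ p))) (zeroʳ _))) ⟩
          ∑[ p ∈ L ] proj₁ p * D′ x′ (fy (proj₂ p))  ≡⟨ ≡.sym (combine-map x′) ⟩
          combine D′ x′ (List.map (map₂ fy) L)       ∎
        ... | inj₂ fx∈ with ∈-map⁻ fx fx∈
        ...   | x , x∈ , ≡.refl = begin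
          D′ (fx x) (fy y)                                ≈⟨ D′∘f≈D x y ⟩
          D x y                                           ≈⟨ D≈L x∈ ⟩
          combine D x L                                   ≈⟨ sumₗ-cong L (λ {p} _ → *-congˡ (sym (D′∘f≈D x (proj₂ p)))) ⟩
          ∑[ p ∈ L ] proj₁ p * D′ (fx x) (fy (proj₂ p))  ≡⟨ ≡.sym (combine-map (fx x)) ⟩
          combine D′ (fx x) (List.map (map₂ fy) L)        ∎

module Chains {c ℓ : Level} (F : Field c ℓ) where

  open Field F hiding (zero)
  open LinearAlgebra F
  open import Algebra.Properties.Ring ring using (-‿distribˡ-*; -‿distribʳ-*; -‿involutive; -0#≈0#)
  open import Algebra.Properties.Semiring.Sum semiring
    using (sum; sum-cong-≋; ∑-distrib-+; *-distribˡ-sum)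
  open import Relation.Binary.Reasoning.Setoid setoid

  sign : ∀ {k} → Fin k → Carrier
  sign j = sgn F (toℕ j)

  module _ {n : ℕ} where

    δᶠ : Fin n → Fin n → Carrier
    δᶠ = δ Fin._≟_

    δᵛ : ∀ {k} → Vec (Fin n) k → Vec (Fin n) k → Carrier
    δᵛ = δ (≡-dec Fin._≟_)

    δᶠ-refl : ∀ x → δᶠ x x ≈ 1#
    δᶠ-refl = δ-refl (Fin._≟_ {n})

    δᶠ-≢ : ∀ {x y} → x ≢ y → δᶠ x y ≈ 0#
    δᶠ-≢ = δ-≢ (Fin._≟_ {n})

    δᵛ-refl : ∀ {k} (xs : Vec (Fin n) k) → δᵛ xs xs ≈ 1#
    δᵛ-refl = δ-refl (≡-dec Fin._≟_)

    δᵛ-≢ : ∀ {k} {xs ys : Vec (Fin n) k} → xs ≢ ys → δᵛ xs ys ≈ 0#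
    δᵛ-≢ = δ-≢ (≡-dec Fin._≟_)

    δᵛ-∷ : ∀ {k} (x y : Fin n) (xs ys : Vec (Fin n) k) → δᵛ (x ∷ xs) (y ∷ ys) ≈ δᶠ x y * δᵛ xs ys
    δᵛ-∷ x y xs ys = if-∧ (does (x Fin.≟ y)) (does (≡-dec Fin._≟_ xs ys))
      where
      if-∧ : ∀ a b → (if a ∧ b then 1# else 0#) ≈ (if a then 1# else 0#) * (if b then 1# else 0#)
      if-∧ true  b = sym (*-identityˡ _)
      if-∧ false b = sym (zeroˡ _)

    δᵛ-head≢ : ∀ {k} {x y : Fin n} (xs ys : Vec (Fin n) k) → x ≢ y → δᵛ (x ∷ xs) (y ∷ ys) ≈ 0#
    δᵛ-head≢ {x = x} {y} xs ys x≢y = δᵛ-≢ {xs = x ∷ xs} {y ∷ ys} (x≢y ∘ ∷-injectiveˡ)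

    incidence : ∀ k → Vec (Fin n) k → Vec (Fin n) (suc k) → Carrier
    incidence k ρ σ = sum (λ j → sign j * δᵛ ρ (removeAt σ j))

  ∂≈incidence : ∀ {n} (G : Graph n) k i j →
                ∂ F G k i j ≈ incidence k (lookup (faces G k) i) (lookup (faces G (suc k)) j)
  ∂≈incidence {n} G k i j =
    trans (reflexive (∑≡sum (suc k) term)) (sum-cong-≋ (λ l → if-as-product (does (≡-dec Fin._≟_ ρ (removeAt σ l))) (sign l)))
    where
    ρ : Vec (Fin n) k
    ρ = lookup (faces G k) i
    σ : Vec (Fin n) (suc k)
    σ = lookup (faces G (suc k)) j
    term : Fin (suc k) → Carrier
    term l = if does (≡-dec Fin._≟_ ρ (removeAt σ l)) then sign l else 0#
    if-as-product : ∀ b x → (if b then x else 0#) ≈ x * (if b then 1# else 0#)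
    if-as-product true  x = sym (*-identityʳ x)
    if-as-product false x = sym (zeroʳ x)

  incidence-cong : ∀ {n n′ k} (ρ : Vec (Fin n) k) σ (ρ′ : Vec (Fin n′) k) σ′ →
                   (∀ j → δᵛ ρ (removeAt σ j) ≈ δᵛ ρ′ (removeAt σ′ j)) → incidence k ρ σ ≈ incidence k ρ′ σ′
  incidence-cong ρ σ ρ′ σ′ δ≈δ′ =
    sum-cong-≋ {x = λ j → sign j * δᵛ ρ (removeAt σ j)} {y = λ j → sign j * δᵛ ρ′ (removeAt σ′ j)} (*-congˡ ∘ δ≈δ′)

  module _ {n : ℕ} where

    incidence-zero : ∀ {k} (ρ : Vec (Fin n) k) σ → (∀ j → δᵛ ρ (removeAt σ j) ≈ 0#) → incidence k ρ σ ≈ 0#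
    incidence-zero ρ σ δ≈0 =
      sum-zero {f = λ j → sign j * δᵛ ρ (removeAt σ j)} (λ j → trans (*-congˡ (δ≈0 j)) (zeroʳ _))

    incidence-vertex : ∀ (x : Fin n) → incidence 0 [] (x ∷ []) ≈ 1#
    incidence-vertex x = trans (+-identityʳ _) (*-identityˡ _)

    incidence-∷ : ∀ k (m x : Fin n) (μ : Vec (Fin n) k) (τ : Vec (Fin n) (suc k)) →
                  incidence (suc k) (m ∷ μ) (x ∷ τ) ≈ δᵛ (m ∷ μ) τ - δᶠ m x * incidence k μ τ
    incidence-∷ k m x μ τ@(_ ∷ _) = begin
      1# * δᵛ (m ∷ μ) τ + sum (λ i → - sign i * δᵛ (m ∷ μ) (x ∷ removeAt τ i))
        ≈⟨ +-cong (*-identityˡ _) (sum-cong-≋ λ i → trans (*-congˡ (δᵛ-∷ m x μ (removeAt τ i))) (pull (sign i) _ _)) ⟩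
      δᵛ (m ∷ μ) τ + sum (λ i → - (δᶠ m x * (sign i * δᵛ μ (removeAt τ i))))
        ≈⟨ +-congˡ (sum-neg (λ i → δᶠ m x * (sign i * δᵛ μ (removeAt τ i)))) ⟩
      δᵛ (m ∷ μ) τ - sum (λ i → δᶠ m x * (sign i * δᵛ μ (removeAt τ i)))
        ≈⟨ +-congˡ (-‿cong (sym (*-distribˡ-sum (δᶠ m x) (λ i → sign i * δᵛ μ (removeAt τ i))))) ⟩
      δᵛ (m ∷ μ) τ - δᶠ m x * incidence k μ τ ∎
      where
      pull : ∀ s e d → - s * (e * d) ≈ - (e * (s * d))
      pull s e d = trans (sym (-‿distribˡ-* s (e * d)))
                         (-‿cong (trans (sym (*-assoc s e d)) (trans (*-congʳ (*-comm s e)) (*-assoc e s d))))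

  ∂∘∂≈0 : ∀ {n} k (μ : Vec (Fin n) k) (σ : Vec (Fin n) (suc (suc k))) →
          sum (λ j → sign j * incidence k μ (removeAt σ j)) ≈ 0#
  ∂∘∂≈0 zero [] (x ∷ y ∷ []) = begin
    1# * incidence 0 [] (y ∷ []) + (- 1# * incidence 0 [] (x ∷ []) + 0#)
      ≈⟨ +-cong (*-congˡ (incidence-vertex y)) (+-identityʳ _) ⟩
    1# * 1# + - 1# * incidence 0 [] (x ∷ [])
      ≈⟨ +-cong (*-identityˡ 1#) (trans (sym (-‿distribˡ-* 1# _)) (-‿cong (trans (*-identityˡ _) (incidence-vertex x)))) ⟩
    1# - 1#
      ≈⟨ -‿inverseʳ 1# ⟩
    0# ∎
  ∂∘∂≈0 (suc k) (m ∷ μ) (x ∷ σ@(_ ∷ _)) = begin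
    1# * incidence (suc k) (m ∷ μ) σ + sum (λ i → - sign i * incidence (suc k) (m ∷ μ) (x ∷ removeAt σ i))
      ≈⟨ +-cong (*-identityˡ _) (sum-cong-≋ λ i → trans (*-congˡ (incidence-∷ k m x μ (removeAt σ i))) (expand (sign i) _ _ _)) ⟩
    ∂σ + sum (λ i → - (sign i * δᵛ (m ∷ μ) (removeAt σ i)) + δᶠ m x * (sign i * incidence k μ (removeAt σ i)))
      ≈⟨ +-congˡ (∑-distrib-+ (λ i → - (sign i * δᵛ (m ∷ μ) (removeAt σ i)))
                              (λ i → δᶠ m x * (sign i * incidence k μ (removeAt σ i)))) ⟩
    ∂σ + (sum (λ i → - (sign i * δᵛ (m ∷ μ) (removeAt σ i))) + sum (λ i → δᶠ m x * (sign i * incidence k μ (removeAt σ i))))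
      ≈⟨ +-congˡ (+-cong (sum-neg (λ i → sign i * δᵛ (m ∷ μ) (removeAt σ i)))
                         (sym (*-distribˡ-sum (δᶠ m x) (λ i → sign i * incidence k μ (removeAt σ i))))) ⟩
    ∂σ + (- ∂σ + δᶠ m x * sum (λ i → sign i * incidence k μ (removeAt σ i)))
      ≈⟨ +-congˡ (+-congˡ (trans (*-congˡ (∂∘∂≈0 k μ σ)) (zeroʳ _))) ⟩
    ∂σ + (- ∂σ + 0#)
      ≈⟨ trans (+-congˡ (+-identityʳ _)) (-‿inverseʳ ∂σ) ⟩
    0# ∎
    where
    ∂σ : Carrier
    ∂σ = incidence (suc k) (m ∷ μ) σ
    expand : ∀ s a e b → - s * (a - e * b) ≈ - (s * a) + e * (s * b)
    expand s a e b = begin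
      - s * (a - e * b)              ≈⟨ distribˡ (- s) a (- (e * b)) ⟩
      - s * a + - s * - (e * b)      ≈⟨ +-cong (sym (-‿distribˡ-* s a)) (trans (sym (-‿distribˡ-* s _)) (-‿cong (sym (-‿distribʳ-* s _)))) ⟩
      - (s * a) + - - (s * (e * b))  ≈⟨ +-congˡ (-‿involutive _) ⟩
      - (s * a) + s * (e * b)        ≈⟨ +-congˡ (trans (sym (*-assoc s e b)) (trans (*-congʳ (*-comm s e)) (*-assoc e s b))) ⟩
      - (s * a) + e * (s * b)        ∎

  module Cone {n n′ : ℕ} (f : Fin n → Fin n′) (f-injective : ∀ {u v} → f u ≡ f v → u ≡ v)
              (h : Fin n′) (f≢h : ∀ v → f v ≢ h) where

    lift : ∀ {k} → Vec (Fin n) k → Vec (Fin n′) k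
    lift = Vec.map f

    δᵛ-lift : ∀ {k} (xs ys : Vec (Fin n) k) → δᵛ (lift xs) (lift ys) ≈ δᵛ xs ys
    δᵛ-lift xs ys with ≡-dec Fin._≟_ xs ys
    ... | yes ≡.refl = δᵛ-refl (lift xs)
    ... | no xs≢ys  = δᵛ-≢ (xs≢ys ∘ map-injective f-injective)

    δᵛ-removeAt-lift : ∀ {k} (ρ : Vec (Fin n′) k) (σ : Vec (Fin n) (suc k)) j →
                       δᵛ ρ (removeAt (lift σ) j) ≡ δᵛ ρ (lift (removeAt σ j))
    δᵛ-removeAt-lift ρ σ j = ≡.cong (δᵛ ρ) (removeAt-map f σ j)

    incidence-lift : ∀ k (μ : Vec (Fin n) k) σ → incidence k (lift μ) (lift σ) ≈ incidence k μ σ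
    incidence-lift k μ σ = incidence-cong (lift μ) (lift σ) μ σ λ j →
      trans (reflexive (δᵛ-removeAt-lift (lift μ) σ j)) (δᵛ-lift μ (removeAt σ j))

    incidence-cone-lift : ∀ k (ρ : Vec (Fin n′) k) σ → incidence (suc k) (h ∷ ρ) (lift σ) ≈ 0#
    incidence-cone-lift k ρ σ = incidence-zero (h ∷ ρ) (lift σ) λ j →
      trans (reflexive (δᵛ-removeAt-lift (h ∷ ρ) σ j)) (apex∉lift (removeAt σ j))
      where
      apex∉lift : ∀ (τ : Vec (Fin n) (suc k)) → δᵛ (h ∷ ρ) (lift τ) ≈ 0#
      apex∉lift (t ∷ τ) = δᵛ-head≢ ρ (lift τ) (f≢h t ∘ ≡.sym)

    incidence-lift-cone : ∀ k (μ τ : Vec (Fin n) k) → incidence k (lift μ) (h ∷ lift τ) ≈ δᵛ μ τ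
    incidence-lift-cone zero    []      []  = incidence-vertex h
    incidence-lift-cone (suc k) (m ∷ μ) τ = begin
      incidence (suc k) (f m ∷ lift μ) (h ∷ lift τ)
        ≈⟨ incidence-∷ k (f m) h (lift μ) (lift τ) ⟩
      δᵛ (lift (m ∷ μ)) (lift τ) - δᶠ (f m) h * incidence k (lift μ) (lift τ)
        ≈⟨ +-cong (δᵛ-lift (m ∷ μ) τ) (-‿cong (trans (*-congʳ (δᶠ-≢ (f≢h m))) (zeroˡ _))) ⟩
      δᵛ (m ∷ μ) τ - 0#
        ≈⟨ trans (+-congˡ -0#≈0#) (+-identityʳ _) ⟩
      δᵛ (m ∷ μ) τ ∎

    incidence-cone-cone : ∀ k (μ : Vec (Fin n) k) (τ : Vec (Fin n) (suc k)) →
                          incidence (suc k) (h ∷ lift μ) (h ∷ lift τ) ≈ - incidence k μ τ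
    incidence-cone-cone k μ τ@(t ∷ _) = begin
      incidence (suc k) (h ∷ lift μ) (h ∷ lift τ)
        ≈⟨ incidence-∷ k h h (lift μ) (lift τ) ⟩
      δᵛ (h ∷ lift μ) (lift τ) - δᶠ h h * incidence k (lift μ) (lift τ)
        ≈⟨ +-cong (δᵛ-head≢ (lift μ) _ (f≢h t ∘ ≡.sym))
                  (-‿cong (trans (*-cong (δᶠ-refl h) (incidence-lift k μ τ)) (*-identityˡ _))) ⟩
      0# - incidence k μ τ
        ≈⟨ +-identityˡ _ ⟩
      - incidence k μ τ ∎

    incidence-cone-othercone : ∀ {h′} → h ≢ h′ → ∀ k (μ : Vec (Fin n) k) (τ : Vec (Fin n) (suc k)) →
                               incidence (suc k) (h ∷ lift μ) (h′ ∷ lift τ) ≈ 0#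
    incidence-cone-othercone {h′} h≢h′ k μ τ@(t ∷ _) = begin
      incidence (suc k) (h ∷ lift μ) (h′ ∷ lift τ)
        ≈⟨ incidence-∷ k h h′ (lift μ) (lift τ) ⟩
      δᵛ (h ∷ lift μ) (lift τ) - δᶠ h h′ * incidence k (lift μ) (lift τ)
        ≈⟨ +-cong (δᵛ-head≢ (lift μ) _ (f≢h t ∘ ≡.sym)) (-‿cong (trans (*-congʳ (δᶠ-≢ h≢h′)) (zeroˡ _))) ⟩
      0# - 0#
        ≈⟨ -‿inverseʳ 0# ⟩
      0# ∎

isolatedVertex : Graph 1
isolatedVertex = record { adj = λ _ _ → false ; symm = λ _ _ → ≡.refl ; irrefl = λ _ → ≡.refl }

addUniversalVertex : ∀ {n} → Graph n → Graph (suc n)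
addUniversalVertex {n} G = record { adj = adj′ ; symm = symm′ ; irrefl = irrefl′ }
  where
  open Graph G
  adj′ : Fin (suc n) → Fin (suc n) → Bool
  adj′ zero    zero    = false
  adj′ zero    (suc _) = true
  adj′ (suc _) zero    = true
  adj′ (suc u) (suc v) = adj u v
  symm′ : ∀ u v → adj′ u v ≡ adj′ v u
  symm′ zero    zero    = ≡.refl
  symm′ zero    (suc _) = ≡.refl
  symm′ (suc _) zero    = ≡.refl
  symm′ (suc u) (suc v) = symm u v
  irrefl′ : ∀ v → adj′ v v ≡ false
  irrefl′ zero    = ≡.refl
  irrefl′ (suc v) = irrefl v

addDisjointEdge : ∀ {n} → Graph n → Graph (suc (suc n))
addDisjointEdge {n} G = record { adj = adj′ ; symm = symm′ ; irrefl = irrefl′ }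
  where
  open Graph G
  adj′ : Fin (suc (suc n)) → Fin (suc (suc n)) → Bool
  adj′ zero          (suc zero)    = true
  adj′ (suc zero)    zero          = true
  adj′ (suc (suc u)) (suc (suc v)) = adj u v
  adj′ _             _             = false
  symm′ : ∀ u v → adj′ u v ≡ adj′ v u
  symm′ zero          zero          = ≡.refl
  symm′ zero          (suc zero)    = ≡.refl
  symm′ zero          (suc (suc _)) = ≡.refl
  symm′ (suc zero)    zero          = ≡.refl
  symm′ (suc zero)    (suc zero)    = ≡.refl
  symm′ (suc zero)    (suc (suc _)) = ≡.refl
  symm′ (suc (suc _)) zero          = ≡.refl
  symm′ (suc (suc _)) (suc zero)    = ≡.refl
  symm′ (suc (suc u)) (suc (suc v)) = symm u v
  irrefl′ : ∀ v → adj′ v v ≡ false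
  irrefl′ zero          = ≡.refl
  irrefl′ (suc zero)    = ≡.refl
  irrefl′ (suc (suc v)) = irrefl v

isFace? : ∀ {n k} (G : Graph n) (σ : Vec (Fin n) k) → Dec (independent G σ ≡ true)
isFace? G σ = independent G σ Bool.≟ true

module _ {n m : ℕ} (G : Graph n) (H : Graph m) where

  independent-map : (f : Fin n → Fin m) → (∀ u v → Graph.adj H (f u) (f v) ≡ Graph.adj G u v) →
                    ∀ {k} (τ : Vec (Fin n) k) → independent H (Vec.map f τ) ≡ independent G τ
  independent-map f adj-f []      = ≡.refl
  independent-map f adj-f (u ∷ τ) = ≡.cong₂ _∧_ (nonAdjAll-map u τ) (independent-map f adj-f τ)
    where
    nonAdjAll-map : ∀ u {k} (τ : Vec (Fin n) k) → nonAdjAll H (f u) (Vec.map f τ) ≡ nonAdjAll G u τ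
    nonAdjAll-map u []      = ≡.refl
    nonAdjAll-map u (v ∷ τ) = ≡.cong₂ (λ a b → not a ∧ b) (adj-f u v) (nonAdjAll-map u τ)

  filter-isFace-map : ∀ {k l} (f g : Vec (Fin n) k → Vec (Fin m) l) → (∀ τ → f τ ≡ g τ) →
                      (∀ τ → independent H (g τ) ≡ independent G τ) →
                      ∀ xs → filter (isFace? H) (List.map f xs) ≡ List.map g (filter (isFace? G) xs)
  filter-isFace-map f g f≗g independent-g []       = ≡.refl
  filter-isFace-map f g f≗g independent-g (τ ∷ xs) rewrite f≗g τ | independent-g τ with independent G τ
  ... | true  = ≡.cong (g τ ∷_) (filter-isFace-map f g f≗g independent-g xs)
  ... | false = filter-isFace-map f g f≗g independent-g xs

  nonAdjAll-map : ∀ h (f : Fin n → Fin m) → (∀ v → Graph.adj H h (f v) ≡ false) →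
                  ∀ {k} (τ : Vec (Fin n) k) → nonAdjAll H h (Vec.map f τ) ≡ true
  nonAdjAll-map h f h≁f []      = ≡.refl
  nonAdjAll-map h f h≁f (v ∷ τ) rewrite h≁f v = nonAdjAll-map h f h≁f τ

filter-isFace-none : ∀ {n m k l} (H : Graph m) (f : Vec (Fin n) k → Vec (Fin m) l) → (∀ τ → independent H (f τ) ≡ false) →
                     ∀ xs → filter (isFace? H) (List.map f xs) ≡ []
filter-isFace-none H f dependent-f []       = ≡.refl
filter-isFace-none H f dependent-f (τ ∷ xs) rewrite dependent-f τ = filter-isFace-none H f dependent-f xs

withZero : ∀ {n k} → Vec (Fin n) k → Vec (Fin (suc n)) (suc k)
withZero τ = zero ∷ Vec.map suc τ

map-subsets : ∀ {b} {B : Set b} {n k} (g : Vec (Fin (suc n)) (suc k) → B) →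
              List.map g (subsets (suc n) (suc k))
              ≡ List.map (g ∘ withZero) (subsets n k) ++ List.map (g ∘ Vec.map suc) (subsets n (suc k))
map-subsets {n = n} {k} g =
  ≡.trans (map-++ g (List.map withZero (subsets n k)) (List.map (Vec.map suc) (subsets n (suc k))))
          (≡.cong₂ _++_ (≡.sym (map-∘ (subsets n k))) (≡.sym (map-∘ (subsets n (suc k)))))

subsets-unique : ∀ n k → Unique (subsets n k)
subsets-unique n       zero    = All.[] ∷ []
subsets-unique zero    (suc k) = []
subsets-unique (suc n) (suc k) =
  Unique.++⁺ (Unique.map⁺ withZero-injective (subsets-unique n k))
             (Unique.map⁺ (map-injective suc-injective) (subsets-unique n (suc k))) disjoint
  where
  withZero-injective : ∀ {x y : Vec (Fin n) k} → withZero x ≡ withZero y → x ≡ y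
  withZero-injective = map-injective suc-injective ∘ proj₂ ∘ ∷-injective
  disjoint : ∀ {σ} → ¬ (σ ∈ List.map withZero (subsets n k) × σ ∈ List.map (Vec.map suc) (subsets n (suc k)))
  disjoint (σ∈₀ , σ∈₁) with ∈-map⁻ withZero σ∈₀ | ∈-map⁻ (Vec.map suc) σ∈₁
  ... | _ , _ , ≡.refl | _ ∷ _ , _ , ()

faces-unique : ∀ {n} (G : Graph n) k → Unique (faces G k)
faces-unique {n} G k = Unique.filter⁺ (isFace? G) (subsets-unique n k)

map-suc-subsets : ∀ {n k} {τ : Vec (Fin n) k} → τ ∈ subsets n k → Vec.map suc τ ∈ subsets (suc n) k
map-suc-subsets {k = zero}  {[]} _   = here ≡.refl
map-suc-subsets {n} {suc k}      τ∈ = ∈-++⁺ʳ (List.map withZero (subsets n k)) (∈-map⁺ (Vec.map suc) τ∈)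

removeAt-subsets : ∀ n k {σ : Vec (Fin n) (suc k)} → σ ∈ subsets n (suc k) → ∀ j → removeAt σ j ∈ subsets n k
removeAt-withZero : ∀ n k {τ : Vec (Fin n) k} → τ ∈ subsets n k → ∀ j → removeAt (withZero τ) j ∈ subsets (suc n) k

removeAt-subsets (suc n) k σ∈ j with ∈-++⁻ (List.map withZero (subsets n k)) σ∈
... | inj₁ σ∈₀ with ∈-map⁻ withZero σ∈₀
...   | τ , τ∈ , ≡.refl = removeAt-withZero n k τ∈ j
removeAt-subsets (suc n) k σ∈ j | inj₂ σ∈₁ with ∈-map⁻ (Vec.map suc) σ∈₁
...   | τ , τ∈ , ≡.refl =
  ≡.subst (_∈ subsets (suc n) k) (≡.sym (removeAt-map suc τ j)) (map-suc-subsets (removeAt-subsets n k τ∈ j))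

removeAt-withZero n k       τ∈ zero = map-suc-subsets τ∈
removeAt-withZero n (suc k) {τ@(_ ∷ _)} τ∈ (suc i) =
  ≡.subst (λ ρ → zero ∷ ρ ∈ subsets (suc n) (suc k)) (≡.sym (removeAt-map suc τ i))
          (∈-++⁺ˡ (∈-map⁺ withZero (removeAt-subsets n k τ∈ i)))

module _ {n : ℕ} (G : Graph n) where

  private
    ∧-split : ∀ {a b} → a ∧ b ≡ true → a ≡ true × b ≡ true
    ∧-split {true} {true} _ = ≡.refl , ≡.refl

    nonAdjAll-removeAt : ∀ u {k} (τ : Vec (Fin n) (suc k)) j → nonAdjAll G u τ ≡ true → nonAdjAll G u (removeAt τ j) ≡ true
    nonAdjAll-removeAt u (v ∷ τ)     zero    u≁τ = proj₂ (∧-split u≁τ)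
    nonAdjAll-removeAt u (v ∷ w ∷ τ) (suc j) u≁τ with ∧-split u≁τ
    ... | u≁v , u≁wτ = ≡.cong₂ _∧_ u≁v (nonAdjAll-removeAt u (w ∷ τ) j u≁wτ)

    independent-removeAt : ∀ {k} (σ : Vec (Fin n) (suc k)) j → independent G σ ≡ true → independent G (removeAt σ j) ≡ true
    independent-removeAt (v ∷ σ)     zero    σ-indep = proj₂ (∧-split σ-indep)
    independent-removeAt (v ∷ w ∷ σ) (suc j) σ-indep with ∧-split σ-indep
    ... | v≁wσ , wσ-indep = ≡.cong₂ _∧_ (nonAdjAll-removeAt v (w ∷ σ) j v≁wσ) (independent-removeAt (w ∷ σ) j wσ-indep)

  removeAt-faces : ∀ k {σ} → σ ∈ faces G (suc k) → ∀ j → removeAt σ j ∈ faces G k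
  removeAt-faces k {σ} σ∈ j with ∈-filter⁻ (isFace? G) {xs = subsets n (suc k)} σ∈
  ... | σ∈subsets , σ-indep = ∈-filter⁺ (isFace? G) (removeAt-subsets n k σ∈subsets j) (independent-removeAt σ j σ-indep)

module _ {n : ℕ} (G : Graph n) where

  private
    G⁺ : Graph (suc n)
    G⁺ = addUniversalVertex G

    independent-suc : ∀ {k} (τ : Vec (Fin n) k) → independent G⁺ (Vec.map suc τ) ≡ independent G τ
    independent-suc = independent-map G G⁺ suc (λ _ _ → ≡.refl)

  faces-addUniversalVertex-1 : faces G⁺ 1 ≡ (zero ∷ []) ∷ List.map (Vec.map suc) (faces G 1)
  faces-addUniversalVertex-1 =
    ≡.cong ((zero ∷ []) ∷_) (filter-isFace-map G G⁺ _ _ (λ _ → ≡.refl) independent-suc (subsets n 1))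

  faces-addUniversalVertex-2+ : ∀ k → faces G⁺ (suc (suc k)) ≡ List.map (Vec.map suc) (faces G (suc (suc k)))
  faces-addUniversalVertex-2+ k = begin
    filter (isFace? G⁺) (List.map withZero (subsets n (suc k)) ++ List.map (Vec.map suc) (subsets n (suc (suc k))))
      ≡⟨ filter-++ (isFace? G⁺) (List.map withZero (subsets n (suc k))) (List.map (Vec.map suc) (subsets n (suc (suc k)))) ⟩
    filter (isFace? G⁺) (List.map withZero (subsets n (suc k))) ++ filter (isFace? G⁺) (List.map (Vec.map suc) (subsets n (suc (suc k))))
      ≡⟨ ≡.cong₂ _++_ (filter-isFace-none G⁺ _ (λ { (_ ∷ _) → ≡.refl }) (subsets n (suc k)))
                      (filter-isFace-map G G⁺ _ _ (λ _ → ≡.refl) independent-suc (subsets n (suc (suc k)))) ⟩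
    List.map (Vec.map suc) (faces G (suc (suc k))) ∎
    where open ≡.≡-Reasoning

shift₂ : ∀ {n} → Fin n → Fin (suc (suc n))
shift₂ v = suc (suc v)

lift₂ : ∀ {n k} → Vec (Fin n) k → Vec (Fin (suc (suc n))) k
lift₂ = Vec.map shift₂

cone₀ cone₁ : ∀ {n k} → Vec (Fin n) k → Vec (Fin (suc (suc n))) (suc k)
cone₀ τ = zero ∷ lift₂ τ
cone₁ τ = suc zero ∷ lift₂ τ

suspension : ∀ {n k} → List (Vec (Fin n) k) → List (Vec (Fin n) (suc k)) → List (Vec (Fin (suc (suc n))) (suc k))
suspension faces₀ faces₁ = List.map cone₀ faces₀ ++ (List.map cone₁ faces₀ ++ List.map lift₂ faces₁)

length-suspension : ∀ {n k} (faces₀ : List (Vec (Fin n) k)) faces₁ →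
                    length (suspension faces₀ faces₁) ≡ length faces₀ ℕ.+ (length faces₀ ℕ.+ length faces₁)
length-suspension faces₀ faces₁ =
  ≡.trans (length-++ (List.map cone₀ faces₀))
          (≡.cong₂ ℕ._+_ (length-map cone₀ faces₀)
                         (≡.trans (length-++ (List.map cone₁ faces₀))
                                  (≡.cong₂ ℕ._+_ (length-map cone₁ faces₀) (length-map lift₂ faces₁))))

cone₁∈suspension : ∀ {n k} {faces₀ : List (Vec (Fin n) k)} {faces₁ τ} → τ ∈ faces₀ → cone₁ τ ∈ suspension faces₀ faces₁
cone₁∈suspension {faces₀ = faces₀} τ∈ = ∈-++⁺ʳ (List.map cone₀ faces₀) (∈-++⁺ˡ (∈-map⁺ cone₁ τ∈))

lift₂∈suspension : ∀ {n k} {faces₀ : List (Vec (Fin n) k)} {faces₁ σ} → σ ∈ faces₁ → lift₂ σ ∈ suspension faces₀ faces₁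
lift₂∈suspension {faces₀ = faces₀} σ∈ = ∈-++⁺ʳ (List.map cone₀ faces₀) (∈-++⁺ʳ (List.map cone₁ faces₀) (∈-map⁺ lift₂ σ∈))

∈-suspension-elim : ∀ {p n k} {faces₀ : List (Vec (Fin n) k)} {faces₁} (P : Vec (Fin (suc (suc n))) (suc k) → Set p) →
                    (∀ {τ} → τ ∈ faces₀ → P (cone₀ τ)) → (∀ {τ} → τ ∈ faces₀ → P (cone₁ τ)) →
                    (∀ {σ} → σ ∈ faces₁ → P (lift₂ σ)) → ∀ {ρ} → ρ ∈ suspension faces₀ faces₁ → P ρ
∈-suspension-elim {faces₀ = faces₀} P P-cone₀ P-cone₁ P-lift₂ ρ∈ with ∈-++⁻ (List.map cone₀ faces₀) ρ∈
... | inj₁ ρ∈₀ with ∈-map⁻ cone₀ ρ∈₀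
...   | _ , τ∈ , ≡.refl = P-cone₀ τ∈
∈-suspension-elim {faces₀ = faces₀} P P-cone₀ P-cone₁ P-lift₂ ρ∈ | inj₂ ρ∈′ with ∈-++⁻ (List.map cone₁ faces₀) ρ∈′
... | inj₁ ρ∈₁ with ∈-map⁻ cone₁ ρ∈₁
...   | _ , τ∈ , ≡.refl = P-cone₁ τ∈
∈-suspension-elim P P-cone₀ P-cone₁ P-lift₂ ρ∈ | inj₂ ρ∈′ | inj₂ ρ∈₂ with ∈-map⁻ lift₂ ρ∈₂
...   | _ , σ∈ , ≡.refl = P-lift₂ σ∈

module _ {n : ℕ} (G : Graph n) where

  private
    ΣG : Graph (suc (suc n))
    ΣG = addDisjointEdge G

    P : ∀ {k} (σ : Vec (Fin (suc (suc n))) k) → Dec (independent ΣG σ ≡ true)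
    P = isFace? ΣG

    lift₂≡ : ∀ {k} (τ : Vec (Fin n) k) → Vec.map suc (Vec.map suc τ) ≡ lift₂ τ
    lift₂≡ τ = ≡.sym (Vec.map-∘ suc suc τ)

    independent-lift₂ : ∀ {k} (τ : Vec (Fin n) k) → independent ΣG (lift₂ τ) ≡ independent G τ
    independent-lift₂ = independent-map G ΣG shift₂ (λ _ _ → ≡.refl)

    independent-cone₀ : ∀ {k} (τ : Vec (Fin n) k) → independent ΣG (cone₀ τ) ≡ independent G τ
    independent-cone₀ τ = ≡.cong₂ _∧_ (nonAdjAll-map G ΣG zero shift₂ (λ _ → ≡.refl) τ) (independent-lift₂ τ)

    independent-cone₁ : ∀ {k} (τ : Vec (Fin n) k) → independent ΣG (cone₁ τ) ≡ independent G τ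
    independent-cone₁ τ = ≡.cong₂ _∧_ (nonAdjAll-map G ΣG (suc zero) shift₂ (λ _ → ≡.refl) τ) (independent-lift₂ τ)

    -- Primed maps are cone₀, cone₁ and lift₂ in the form in which they come out of unfolding subsets.
    faces-cone₀ : ∀ k → filter P (List.map withZero (subsets (suc n) k)) ≡ List.map cone₀ (faces G k)
    faces-cone₀ zero    = ≡.refl
    faces-cone₀ (suc k) = begin
      filter P (List.map withZero (subsets (suc n) (suc k)))
        ≡⟨ ≡.cong (filter P) (map-subsets withZero) ⟩
      filter P (List.map withEdge (subsets n k) ++ List.map cone₀′ (subsets n (suc k)))
        ≡⟨ filter-++ P (List.map withEdge (subsets n k)) (List.map cone₀′ (subsets n (suc k))) ⟩
      filter P (List.map withEdge (subsets n k)) ++ filter P (List.map cone₀′ (subsets n (suc k)))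
        ≡⟨ ≡.cong₂ _++_ (filter-isFace-none ΣG withEdge (λ _ → ≡.refl) (subsets n k))
                        (filter-isFace-map G ΣG cone₀′ cone₀ (≡.cong (zero ∷_) ∘ lift₂≡) independent-cone₀ (subsets n (suc k))) ⟩
      List.map cone₀ (faces G (suc k)) ∎
      where
      open ≡.≡-Reasoning
      withEdge : Vec (Fin n) k → Vec (Fin (suc (suc n))) (suc (suc k))
      withEdge τ = zero ∷ suc zero ∷ Vec.map suc (Vec.map suc τ)
      cone₀′ : Vec (Fin n) (suc k) → Vec (Fin (suc (suc n))) (suc (suc k))
      cone₀′ τ = zero ∷ Vec.map suc (Vec.map suc τ)

    faces-lift : ∀ k → filter P (List.map (Vec.map suc) (subsets (suc n) (suc k)))
                       ≡ List.map cone₁ (faces G k) ++ List.map lift₂ (faces G (suc k))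
    faces-lift k = begin
      filter P (List.map (Vec.map suc) (subsets (suc n) (suc k)))
        ≡⟨ ≡.cong (filter P) (map-subsets (Vec.map suc)) ⟩
      filter P (List.map cone₁′ (subsets n k) ++ List.map lift₂′ (subsets n (suc k)))
        ≡⟨ filter-++ P (List.map cone₁′ (subsets n k)) (List.map lift₂′ (subsets n (suc k))) ⟩
      filter P (List.map cone₁′ (subsets n k)) ++ filter P (List.map lift₂′ (subsets n (suc k)))
        ≡⟨ ≡.cong₂ _++_ (filter-isFace-map G ΣG cone₁′ cone₁ (≡.cong (suc zero ∷_) ∘ lift₂≡) independent-cone₁ (subsets n k))
                        (filter-isFace-map G ΣG lift₂′ lift₂ lift₂≡ independent-lift₂ (subsets n (suc k))) ⟩
      List.map cone₁ (faces G k) ++ List.map lift₂ (faces G (suc k)) ∎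
      where
      open ≡.≡-Reasoning
      cone₁′ : Vec (Fin n) k → Vec (Fin (suc (suc n))) (suc k)
      cone₁′ τ = suc zero ∷ Vec.map suc (Vec.map suc τ)
      lift₂′ : Vec (Fin n) (suc k) → Vec (Fin (suc (suc n))) (suc k)
      lift₂′ τ = Vec.map suc (Vec.map suc τ)

  faces-addDisjointEdge : ∀ k → faces ΣG (suc k) ≡ suspension (faces G k) (faces G (suc k))
  faces-addDisjointEdge k =
    ≡.trans (filter-++ P (List.map withZero (subsets (suc n) k)) (List.map (Vec.map suc) (subsets (suc n) (suc k))))
            (≡.cong₂ _++_ (faces-cone₀ k) (faces-lift k))

module Ranks {c ℓ : Level} (F : Field c ℓ) where

  open Field F hiding (zero)
  open LinearAlgebra F
  open Chains F
  open import Algebra.Properties.Ring ring using (-‿distribˡ-*; -‿distribʳ-*; -‿involutive; -0#≈0#)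
  open import Algebra.Properties.Semiring.Sum semiring using (sum; sum-cong-≋)
  open import Relation.Binary.Reasoning.Setoid setoid

  ColumnBasis-vertices : ∀ {n} (v : Fin n) (vs : List (Vec (Fin n) 1)) →
                         ColumnBasis (incidence 0) ([] ∷ []) ((v ∷ []) ∷ vs) 1
  ColumnBasis-vertices v vs = record
    { basis             = (v ∷ []) ∷ []
    ; length-basis      = ≡.refl
    ; basis⊆cols        = λ { (here ≡.refl) → here ≡.refl }
    ; basis-unique      = All.[] ∷ []
    ; basis-independent = λ a a·∂≈0 → λ { (here ≡.refl) → trans (sym (coefficient (a (v ∷ [])))) (a·∂≈0 (here ≡.refl)) }
    ; basis-spans       = λ {y} _ → (1# , v ∷ []) ∷ [] , (λ { (here ≡.refl) → here ≡.refl }) ,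
                                    λ { (here ≡.refl) → trans (incidence-vertex′ y) (sym (coefficient 1#)) }
    }
    where
    coefficient : ∀ a → a * incidence 0 [] (v ∷ []) + 0# ≈ a
    coefficient a = trans (+-identityʳ _) (trans (*-congˡ (incidence-vertex v)) (*-identityʳ a))
    incidence-vertex′ : ∀ (y : Vec _ 1) → incidence 0 [] y ≈ 1#
    incidence-vertex′ (w ∷ []) = incidence-vertex w

  module _ {n : ℕ} where

    private
      module Apex₀ = Cone {n} shift₂ (suc-injective ∘ suc-injective) zero (λ _ ())
      module Apex₁ = Cone {n} shift₂ (suc-injective ∘ suc-injective) (suc zero) (λ _ ())

    ColumnBasis-suspension : ∀ {k r} {R : List (Vec (Fin n) k)} {C : List (Vec (Fin n) (suc k))} {E : List (Vec (Fin n) (suc (suc k)))} →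
                             Unique C → (∀ {σ} → σ ∈ E → ∀ j → removeAt σ j ∈ C) → ColumnBasis (incidence k) R C r →
                             ColumnBasis (incidence (suc k)) (suspension R C) (suspension C E) (length C ℕ.+ r)
    ColumnBasis-suspension {k} {r} {R} {C} {E} C-unique removeAt∈C B = record
      { basis             = basis′
      ; length-basis      = ≡.trans (length-++ (List.map cone₀ C))
                                    (≡.cong₂ ℕ._+_ (length-map cone₀ C) (≡.trans (length-map cone₁ basis) length-basis))
      ; basis⊆cols        = basis′⊆cols
      ; basis-unique      = Unique.++⁺ (Unique.map⁺ cone-injective C-unique) (Unique.map⁺ cone-injective basis-unique) cone₀≢cone₁
      ; basis-independent = λ a a·D′≈0 → Independence.a≈0 a a·D′≈0
      ; basis-spans       = ∈-suspension-elim (InSpan D′ (suspension R C) basis′) spans-cone₀ spans-cone₁ spans-lift₂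
      }
      where
      open ColumnBasis B
      Vertices : ℕ → Set
      Vertices = Vec (Fin (suc (suc n)))

      D : Vec (Fin n) k → Vec (Fin n) (suc k) → Carrier
      D = incidence k
      D′ : Vertices (suc k) → Vertices (suc (suc k)) → Carrier
      D′ = incidence (suc k)

      basis′ : List (Vertices (suc (suc k)))
      basis′ = List.map cone₀ C ++ List.map cone₁ basis

      basis′⊆cols : basis′ ⊆ suspension C E
      basis′⊆cols y∈ with ∈-++⁻ (List.map cone₀ C) y∈
      ... | inj₁ y∈₀ = ∈-++⁺ˡ y∈₀
      ... | inj₂ y∈₁ = ∈-++⁺ʳ (List.map cone₀ C) (∈-++⁺ˡ (⊆-map⁺ cone₁ basis⊆cols y∈₁))

      cone-injective : ∀ {h : Fin (suc (suc n))} {τ τ′ : Vec (Fin n) (suc k)} → h ∷ lift₂ τ ≡ h ∷ lift₂ τ′ → τ ≡ τ′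
      cone-injective = map-injective (suc-injective ∘ suc-injective) ∘ proj₂ ∘ ∷-injective

      cone₀≢cone₁ : ∀ {y} → ¬ (y ∈ List.map cone₀ C × y ∈ List.map cone₁ basis)
      cone₀≢cone₁ (y∈₀ , y∈₁) with ∈-map⁻ cone₀ y∈₀ | ∈-map⁻ cone₁ y∈₁
      ... | _ , _ , ≡.refl | _ , _ , ()

      -- With rows and columns grouped as (cone₀, cone₁, lift₂), D′ is the block matrix
      --   ( −D  0  0 )
      --   (  0 −D  0 )
      --   (  1  1  ∂ )
      D′₀₀ : ∀ μ τ → D′ (cone₀ μ) (cone₀ τ) ≈ - D μ τ
      D′₀₀ = Apex₀.incidence-cone-cone k
      D′₀₁ : ∀ μ τ → D′ (cone₀ μ) (cone₁ τ) ≈ 0#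
      D′₀₁ = Apex₀.incidence-cone-othercone (λ ()) k
      D′₀ₗ : ∀ μ σ → D′ (cone₀ μ) (lift₂ σ) ≈ 0#
      D′₀ₗ μ = Apex₀.incidence-cone-lift k (lift₂ μ)
      D′₁₀ : ∀ μ τ → D′ (cone₁ μ) (cone₀ τ) ≈ 0#
      D′₁₀ = Apex₁.incidence-cone-othercone (λ ()) k
      D′₁₁ : ∀ μ τ → D′ (cone₁ μ) (cone₁ τ) ≈ - D μ τ
      D′₁₁ = Apex₁.incidence-cone-cone k
      D′₁ₗ : ∀ μ σ → D′ (cone₁ μ) (lift₂ σ) ≈ 0#
      D′₁ₗ μ = Apex₁.incidence-cone-lift k (lift₂ μ)
      D′ₗ₀ : ∀ μ τ → D′ (lift₂ μ) (cone₀ τ) ≈ δᵛ μ τ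
      D′ₗ₀ = Apex₀.incidence-lift-cone (suc k)
      D′ₗ₁ : ∀ μ τ → D′ (lift₂ μ) (cone₁ τ) ≈ δᵛ μ τ
      D′ₗ₁ = Apex₁.incidence-lift-cone (suc k)
      D′ₗₗ : ∀ μ σ → D′ (lift₂ μ) (lift₂ σ) ≈ incidence (suc k) μ σ
      D′ₗₗ = Apex₀.incidence-lift (suc k)

      split : ∀ (a : Vertices (suc (suc k)) → Carrier) x →
              ∑[ y ∈ basis′ ] a y * D′ x y ≈ (∑[ τ ∈ C ] a (cone₀ τ) * D′ x (cone₀ τ)) + (∑[ τ ∈ basis ] a (cone₁ τ) * D′ x (cone₁ τ))
      split a x = trans (sumₗ-++ (List.map cone₀ C) (List.map cone₁ basis) (λ y → a y * D′ x y))
                        (reflexive (≡.cong₂ _+_ (sumₗ-map cone₀ C (λ y → a y * D′ x y)) (sumₗ-map cone₁ basis (λ y → a y * D′ x y))))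

      module Independence (a : Vertices (suc (suc k)) → Carrier)
                          (a·D′≈0 : ∀ {x} → x ∈ suspension R C → ∑[ y ∈ basis′ ] a y * D′ x y ≈ 0#) where

        a∘cone₁≈0 : ∀ {τ} → τ ∈ basis → a (cone₁ τ) ≈ 0#
        a∘cone₁≈0 = basis-independent (a ∘ cone₁) λ {μ} μ∈ → begin
          ∑[ τ ∈ basis ] a (cone₁ τ) * D μ τ                    ≈⟨ sym (-‿involutive _) ⟩
          - - (∑[ τ ∈ basis ] a (cone₁ τ) * D μ τ)              ≈⟨ -‿cong (sym (negated μ)) ⟩
          - (∑[ τ ∈ basis ] a (cone₁ τ) * D′ (cone₁ μ) (cone₁ τ)) ≈⟨ -‿cong (row-cone₁ μ∈) ⟩
          - 0#                                                  ≈⟨ -0#≈0# ⟩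
          0#                                                    ∎
          where
          negated : ∀ μ → ∑[ τ ∈ basis ] a (cone₁ τ) * D′ (cone₁ μ) (cone₁ τ) ≈ - (∑[ τ ∈ basis ] a (cone₁ τ) * D μ τ)
          negated μ = trans (sumₗ-cong basis (λ {τ} _ → trans (*-congˡ (D′₁₁ μ τ)) (sym (-‿distribʳ-* _ _))))
                            (sumₗ-neg basis (λ τ → a (cone₁ τ) * D μ τ))
          row-cone₁ : ∀ {μ} → μ ∈ R → ∑[ τ ∈ basis ] a (cone₁ τ) * D′ (cone₁ μ) (cone₁ τ) ≈ 0#
          row-cone₁ {μ} μ∈ = begin
            ∑[ τ ∈ basis ] a (cone₁ τ) * D′ (cone₁ μ) (cone₁ τ)
              ≈⟨ sym (+-identityˡ _) ⟩
            0# + (∑[ τ ∈ basis ] a (cone₁ τ) * D′ (cone₁ μ) (cone₁ τ))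
              ≈⟨ +-congʳ (sym (sumₗ-zero C (λ {τ} _ → trans (*-congˡ (D′₁₀ μ τ)) (zeroʳ _)))) ⟩
            (∑[ τ ∈ C ] a (cone₀ τ) * D′ (cone₁ μ) (cone₀ τ)) + (∑[ τ ∈ basis ] a (cone₁ τ) * D′ (cone₁ μ) (cone₁ τ))
              ≈⟨ sym (split a (cone₁ μ)) ⟩
            ∑[ y ∈ basis′ ] a y * D′ (cone₁ μ) y
              ≈⟨ a·D′≈0 (cone₁∈suspension {faces₁ = C} μ∈) ⟩
            0# ∎

        a∘cone₀≈0 : ∀ {μ} → μ ∈ C → a (cone₀ μ) ≈ 0#
        a∘cone₀≈0 {μ} μ∈ = begin
          a (cone₀ μ)                                                 ≈⟨ sym (sumₗ-δ (≡-dec Fin._≟_) C-unique (a ∘ cone₀) μ∈) ⟩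
          ∑[ τ ∈ C ] a (cone₀ τ) * δᵛ μ τ                             ≈⟨ sym (+-identityʳ _) ⟩
          (∑[ τ ∈ C ] a (cone₀ τ) * δᵛ μ τ) + 0#
            ≈⟨ +-cong (sumₗ-cong C (λ {τ} _ → *-congˡ (sym (D′ₗ₀ μ τ))))
                      (sym (sumₗ-zero basis (λ {τ} τ∈ → trans (*-congʳ (a∘cone₁≈0 τ∈)) (zeroˡ _)))) ⟩
          (∑[ τ ∈ C ] a (cone₀ τ) * D′ (lift₂ μ) (cone₀ τ)) + (∑[ τ ∈ basis ] a (cone₁ τ) * D′ (lift₂ μ) (cone₁ τ))
            ≈⟨ sym (split a (lift₂ μ)) ⟩
          ∑[ y ∈ basis′ ] a y * D′ (lift₂ μ) y                        ≈⟨ a·D′≈0 (lift₂∈suspension {faces₀ = R} μ∈) ⟩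
          0#                                                          ∎

        a≈0 : ∀ {y} → y ∈ basis′ → a y ≈ 0#
        a≈0 y∈ with ∈-++⁻ (List.map cone₀ C) y∈
        ... | inj₁ y∈₀ with ∈-map⁻ cone₀ y∈₀
        ...   | _ , τ∈ , ≡.refl = a∘cone₀≈0 τ∈
        a≈0 y∈ | inj₂ y∈₁ with ∈-map⁻ cone₁ y∈₁
        ...   | _ , τ∈ , ≡.refl = a∘cone₁≈0 τ∈

      spans-cone₀ : ∀ {τ} → τ ∈ C → InSpan D′ (suspension R C) basis′ (cone₀ τ)
      spans-cone₀ τ∈ = InSpan-member (∈-++⁺ˡ (∈-map⁺ cone₀ τ∈))

      -- The column cone₁ τ − cone₀ τ is (D(·,τ), −D(·,τ), 0), so it inherits the expansion of τ in the basis.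
      spans-cone₁ : ∀ {τ} → τ ∈ C → InSpan D′ (suspension R C) basis′ (cone₁ τ)
      spans-cone₁ {τ} τ∈ with basis-spans τ∈
      ... | L , L⊆basis , D≈L = L′ , L′⊆basis′ , D′≈L′
        where
        negate₀ : Carrier × Vec (Fin n) (suc k) → Carrier × Vertices (suc (suc k))
        negate₀ (a , y) = - a , cone₀ y
        L′ : List (Carrier × Vertices (suc (suc k)))
        L′ = (1# , cone₀ τ) ∷ (List.map (map₂ cone₁) L ++ List.map negate₀ L)

        L′⊆basis′ : ∀ {p} → p ∈ L′ → proj₂ p ∈ basis′
        L′⊆basis′ (here ≡.refl) = ∈-++⁺ˡ (∈-map⁺ cone₀ τ∈)
        L′⊆basis′ (there p∈) with ∈-++⁻ (List.map (map₂ cone₁) L) p∈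
        ... | inj₁ p∈₁ with ∈-map⁻ (map₂ cone₁) p∈₁
        ...   | _ , q∈ , ≡.refl = ∈-++⁺ʳ (List.map cone₀ C) (∈-map⁺ cone₁ (L⊆basis q∈))
        L′⊆basis′ (there p∈) | inj₂ p∈₀ with ∈-map⁻ negate₀ p∈₀
        ...   | _ , q∈ , ≡.refl = ∈-++⁺ˡ (∈-map⁺ cone₀ (basis⊆cols (L⊆basis q∈)))

        W : Vertices (suc k) → Vec (Fin n) (suc k) → Carrier
        W x y = D′ x (cone₁ y) - D′ x (cone₀ y)

        combine-L′ : ∀ x → combine D′ x L′ ≈ D′ x (cone₀ τ) + (∑[ p ∈ L ] proj₁ p * W x (proj₂ p))
        combine-L′ x = begin
          1# * D′ x (cone₀ τ) + combine D′ x (List.map (map₂ cone₁) L ++ List.map negate₀ L)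
            ≈⟨ +-cong (*-identityˡ _) (sumₗ-++ (List.map (map₂ cone₁) L) (List.map negate₀ L) (λ p → proj₁ p * D′ x (proj₂ p))) ⟩
          D′ x (cone₀ τ) + (combine D′ x (List.map (map₂ cone₁) L) + combine D′ x (List.map negate₀ L))
            ≡⟨ ≡.cong₂ (λ u v → D′ x (cone₀ τ) + (u + v)) (sumₗ-map (map₂ cone₁) L (λ p → proj₁ p * D′ x (proj₂ p)))
                                                          (sumₗ-map negate₀ L (λ p → proj₁ p * D′ x (proj₂ p))) ⟩
          D′ x (cone₀ τ) + ((∑[ p ∈ L ] proj₁ p * D′ x (cone₁ (proj₂ p))) + (∑[ p ∈ L ] - proj₁ p * D′ x (cone₀ (proj₂ p))))
            ≈⟨ +-congˡ (sym (sumₗ-+ L (λ p → proj₁ p * D′ x (cone₁ (proj₂ p))) (λ p → - proj₁ p * D′ x (cone₀ (proj₂ p))))) ⟩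
          D′ x (cone₀ τ) + (∑[ p ∈ L ] (proj₁ p * D′ x (cone₁ (proj₂ p)) + - proj₁ p * D′ x (cone₀ (proj₂ p))))
            ≈⟨ +-congˡ (sumₗ-cong L (λ {p} _ → factor (proj₁ p) _ _)) ⟩
          D′ x (cone₀ τ) + (∑[ p ∈ L ] proj₁ p * W x (proj₂ p)) ∎
          where
          factor : ∀ a u v → a * u + - a * v ≈ a * (u - v)
          factor a u v = trans (+-congˡ (trans (sym (-‿distribˡ-* a v)) (-‿distribʳ-* a v))) (sym (distribˡ a u (- v)))

        D′≈L′ : ∀ {x} → x ∈ suspension R C → D′ x (cone₁ τ) ≈ combine D′ x L′
        D′≈L′ = ∈-suspension-elim (λ x → D′ x (cone₁ τ) ≈ combine D′ x L′) row-cone₀ row-cone₁ row-lift₂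
          where
          row-cone₀ : ∀ {μ} → μ ∈ R → D′ (cone₀ μ) (cone₁ τ) ≈ combine D′ (cone₀ μ) L′
          row-cone₀ {μ} μ∈ = sym (begin
            combine D′ (cone₀ μ) L′                               ≈⟨ combine-L′ (cone₀ μ) ⟩
            D′ (cone₀ μ) (cone₀ τ) + (∑[ p ∈ L ] proj₁ p * W (cone₀ μ) (proj₂ p))
              ≈⟨ +-cong (D′₀₀ μ τ) (sumₗ-cong L (λ {p} _ → *-congˡ (W≈D (proj₂ p)))) ⟩
            - D μ τ + combine D μ L                               ≈⟨ +-congˡ (sym (D≈L μ∈)) ⟩
            - D μ τ + D μ τ                                       ≈⟨ -‿inverseˡ _ ⟩
            0#                                                    ≈⟨ sym (D′₀₁ μ τ) ⟩
            D′ (cone₀ μ) (cone₁ τ)                                ∎)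
            where
            W≈D : ∀ y → W (cone₀ μ) y ≈ D μ y
            W≈D y = trans (+-cong (D′₀₁ μ y) (-‿cong (D′₀₀ μ y))) (trans (+-identityˡ _) (-‿involutive _))
          row-cone₁ : ∀ {μ} → μ ∈ R → D′ (cone₁ μ) (cone₁ τ) ≈ combine D′ (cone₁ μ) L′
          row-cone₁ {μ} μ∈ = sym (begin
            combine D′ (cone₁ μ) L′                               ≈⟨ combine-L′ (cone₁ μ) ⟩
            D′ (cone₁ μ) (cone₀ τ) + (∑[ p ∈ L ] proj₁ p * W (cone₁ μ) (proj₂ p))
              ≈⟨ +-cong (D′₁₀ μ τ) (sumₗ-cong L (λ {p} _ → trans (*-congˡ (W≈-D (proj₂ p))) (sym (-‿distribʳ-* _ _)))) ⟩
            0# + (∑[ p ∈ L ] - (proj₁ p * D μ (proj₂ p)))         ≈⟨ trans (+-identityˡ _) (sumₗ-neg L (λ p → proj₁ p * D μ (proj₂ p))) ⟩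
            - combine D μ L                                       ≈⟨ -‿cong (sym (D≈L μ∈)) ⟩
            - D μ τ                                               ≈⟨ sym (D′₁₁ μ τ) ⟩
            D′ (cone₁ μ) (cone₁ τ)                                ∎)
            where
            W≈-D : ∀ y → W (cone₁ μ) y ≈ - D μ y
            W≈-D y = trans (+-cong (D′₁₁ μ y) (trans (-‿cong (D′₁₀ μ y)) -0#≈0#)) (+-identityʳ _)
          row-lift₂ : ∀ {μ} → μ ∈ C → D′ (lift₂ μ) (cone₁ τ) ≈ combine D′ (lift₂ μ) L′
          row-lift₂ {μ} μ∈ = sym (begin
            combine D′ (lift₂ μ) L′                               ≈⟨ combine-L′ (lift₂ μ) ⟩
            D′ (lift₂ μ) (cone₀ τ) + (∑[ p ∈ L ] proj₁ p * W (lift₂ μ) (proj₂ p))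
              ≈⟨ +-cong (D′ₗ₀ μ τ) (sumₗ-zero L (λ {p} _ → trans (*-congˡ (W≈0 (proj₂ p))) (zeroʳ _))) ⟩
            δᵛ μ τ + 0#                                           ≈⟨ +-identityʳ _ ⟩
            δᵛ μ τ                                                ≈⟨ sym (D′ₗ₁ μ τ) ⟩
            D′ (lift₂ μ) (cone₁ τ)                                ∎)
            where
            W≈0 : ∀ y → W (lift₂ μ) y ≈ 0#
            W≈0 y = trans (+-cong (D′ₗ₁ μ y) (-‿cong (D′ₗ₀ μ y))) (-‿inverseʳ _)

      -- The column lift₂ σ is ∑ⱼ ± cone₀ (σ without its j-th vertex): on the cone₀ rows this is ∂∂ = 0.
      spans-lift₂ : ∀ {σ} → σ ∈ E → InSpan D′ (suspension R C) basis′ (lift₂ σ)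
      spans-lift₂ {σ} σ∈ = L′ , L′⊆basis′ , D′≈L′
        where
        term : Fin (suc (suc k)) → Carrier × Vertices (suc (suc k))
        term j = sign j , cone₀ (removeAt σ j)
        L′ : List (Carrier × Vertices (suc (suc k)))
        L′ = List.tabulate term

        L′⊆basis′ : ∀ {p} → p ∈ L′ → proj₂ p ∈ basis′
        L′⊆basis′ p∈ with ∈-tabulate⁻ {f = term} p∈
        ... | j , ≡.refl = ∈-++⁺ˡ (∈-map⁺ cone₀ (removeAt∈C σ∈ j))

        combine-L′ : ∀ x → combine D′ x L′ ≡ sum (λ j → sign j * D′ x (cone₀ (removeAt σ j)))
        combine-L′ x = sumₗ-tabulate term (λ p → proj₁ p * D′ x (proj₂ p))

        D′≈L′ : ∀ {x} → x ∈ suspension R C → D′ x (lift₂ σ) ≈ combine D′ x L′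
        D′≈L′ = ∈-suspension-elim (λ x → D′ x (lift₂ σ) ≈ combine D′ x L′) row-cone₀ row-cone₁ row-lift₂
          where
          row-cone₀ : ∀ {μ} → μ ∈ R → D′ (cone₀ μ) (lift₂ σ) ≈ combine D′ (cone₀ μ) L′
          row-cone₀ {μ} _ = sym (begin
            combine D′ (cone₀ μ) L′                                  ≡⟨ combine-L′ (cone₀ μ) ⟩
            sum (λ j → sign j * D′ (cone₀ μ) (cone₀ (removeAt σ j)))
              ≈⟨ sum-cong-≋ (λ j → trans (*-congˡ {sign j} (D′₀₀ μ (removeAt σ j))) (sym (-‿distribʳ-* (sign j) _))) ⟩
            sum (λ j → - (sign j * D μ (removeAt σ j)))              ≈⟨ sum-neg (λ j → sign j * D μ (removeAt σ j)) ⟩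
            - sum (λ j → sign j * D μ (removeAt σ j))                ≈⟨ -‿cong (∂∘∂≈0 k μ σ) ⟩
            - 0#                                                     ≈⟨ -0#≈0# ⟩
            0#                                                       ≈⟨ sym (D′₀ₗ μ σ) ⟩
            D′ (cone₀ μ) (lift₂ σ)                                   ∎)
          row-cone₁ : ∀ {μ} → μ ∈ R → D′ (cone₁ μ) (lift₂ σ) ≈ combine D′ (cone₁ μ) L′
          row-cone₁ {μ} _ = trans (D′₁ₗ μ σ) (sym (trans (reflexive (combine-L′ (cone₁ μ)))
                                                  (sum-zero (λ j → trans (*-congˡ {sign j} (D′₁₀ μ (removeAt σ j))) (zeroʳ _)))))
          row-lift₂ : ∀ {μ} → μ ∈ C → D′ (lift₂ μ) (lift₂ σ) ≈ combine D′ (lift₂ μ) L′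
          row-lift₂ {μ} _ = begin
            D′ (lift₂ μ) (lift₂ σ)                                   ≈⟨ D′ₗₗ μ σ ⟩
            sum (λ j → sign j * δᵛ μ (removeAt σ j))                 ≈⟨ sum-cong-≋ (λ j → *-congˡ {sign j} (sym (D′ₗ₀ μ (removeAt σ j)))) ⟩
            sum (λ j → sign j * D′ (lift₂ μ) (cone₀ (removeAt σ j))) ≡⟨ ≡.sym (combine-L′ (lift₂ μ)) ⟩
            combine D′ (lift₂ μ) L′                                  ∎

  -- rank-0 records that G is nonempty (∂₀ is the augmentation); the suspension step needs it for β̃₀ = 0.
  record RankData {n} (G : Graph n) (σ : List ℕ) : Set (c ⊔ ℓ) where
    field
      rank           : ℕ → ℕ
      rank-0         : rank 0 ≡ 1
      boundary-basis : ∀ k → ColumnBasis (incidence k) (faces G k) (faces G (suc k)) (rank k)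
      nFaces≡        : ∀ i → nFaces G (suc i) ≡ entry σ i ℕ.+ rank i ℕ.+ rank (suc i)

    reducedBetti : ∀ i → ReducedBetti F G i (entry σ i)
    reducedBetti i = rank i , rank (suc i) , hasRank i , hasRank (suc i) , nFaces≡ i
      where
      hasRank : ∀ k → HasRank F (∂ F G k) (rank k)
      hasRank k = HasRank-cong (λ i j → sym (∂≈incidence G k i j)) (columnBasis⇒hasRank (≡-dec Fin._≟_) (boundary-basis k))

  rankData-isolatedVertex : RankData isolatedVertex []
  rankData-isolatedVertex = record { rank = rank ; rank-0 = ≡.refl ; boundary-basis = basis ; nFaces≡ = nFaces≡ }
    where
    rank : ℕ → ℕ
    rank zero    = 1
    rank (suc _) = 0
    basis : ∀ k → ColumnBasis (incidence k) (faces isolatedVertex k) (faces isolatedVertex (suc k)) (rank k)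
    basis zero    = ColumnBasis-vertices zero []
    basis (suc k) = ColumnBasis-empty
    nFaces≡ : ∀ i → nFaces isolatedVertex (suc i) ≡ entry [] i ℕ.+ rank i ℕ.+ rank (suc i)
    nFaces≡ zero    = ≡.refl
    nFaces≡ (suc i) = ≡.refl

  rankData-addUniversalVertex : ∀ {n} {G : Graph n} {b σ} → RankData G (b ∷ σ) → RankData (addUniversalVertex G) (suc b ∷ σ)
  rankData-addUniversalVertex {n} {G} {b} {σ} D = record { rank = rank ; rank-0 = rank-0 ; boundary-basis = basis ; nFaces≡ = nFaces≡′ }
    where
    open RankData D
    open Cone {n} suc suc-injective zero (λ _ ())
    embed : ∀ {k} {zeroRows : List (Vec (Fin (suc n)) (suc k))} → (∀ {z} → z ∈ zeroRows → ∀ y → incidence (suc k) z (lift y) ≈ 0#) →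
            ColumnBasis (incidence (suc k)) (faces G (suc k)) (faces G (suc (suc k))) (rank (suc k)) →
            ColumnBasis (incidence (suc k)) (zeroRows ++ List.map lift (faces G (suc k))) (List.map lift (faces G (suc (suc k)))) (rank (suc k))
    embed {k} zeroRows≈0 = ColumnBasis-embed lift lift (map-injective suc-injective) (incidence-lift (suc k)) zeroRows≈0
    basis : ∀ k → ColumnBasis (incidence k) (faces (addUniversalVertex G) k) (faces (addUniversalVertex G) (suc k)) (rank k)
    basis zero          = ≡.subst₂ (ColumnBasis (incidence 0) ([] ∷ [])) (≡.sym (faces-addUniversalVertex-1 G)) (≡.sym rank-0)
                                   (ColumnBasis-vertices zero _)
    basis (suc zero)    = ≡.subst₂ (λ R C → ColumnBasis (incidence 1) R C (rank 1))
                                   (≡.sym (faces-addUniversalVertex-1 G)) (≡.sym (faces-addUniversalVertex-2+ G 0))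
                                   (embed (λ { (here ≡.refl) → incidence-cone-lift 0 [] }) (boundary-basis 1))
    basis (suc (suc k)) = ≡.subst₂ (λ R C → ColumnBasis (incidence (suc (suc k))) R C (rank (suc (suc k))))
                                   (≡.sym (faces-addUniversalVertex-2+ G k)) (≡.sym (faces-addUniversalVertex-2+ G (suc k)))
                                   (embed {zeroRows = []} (λ ()) (boundary-basis (suc (suc k))))
    nFaces≡′ : ∀ i → nFaces (addUniversalVertex G) (suc i) ≡ entry (suc b ∷ σ) i ℕ.+ rank i ℕ.+ rank (suc i)
    nFaces≡′ zero    = ≡.trans (≡.cong length (faces-addUniversalVertex-1 G))
                               (≡.cong suc (≡.trans (length-map lift (faces G 1)) (nFaces≡ 0)))
    nFaces≡′ (suc i) = ≡.trans (≡.cong length (faces-addUniversalVertex-2+ G i))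
                               (≡.trans (length-map lift (faces G (suc (suc i)))) (nFaces≡ (suc i)))

  rankData-addDisjointEdge : ∀ {n} {G : Graph n} {σ} → RankData G σ → RankData (addDisjointEdge G) (0 ∷ σ)
  rankData-addDisjointEdge {n} {G} {σ} D = record { rank = rank′ ; rank-0 = ≡.refl ; boundary-basis = basis ; nFaces≡ = nFaces≡′ }
    where
    open RankData D
    rank′ : ℕ → ℕ
    rank′ zero    = 1
    rank′ (suc k) = nFaces G (suc k) ℕ.+ rank k
    basis : ∀ k → ColumnBasis (incidence k) (faces (addDisjointEdge G) k) (faces (addDisjointEdge G) (suc k)) (rank′ k)
    basis zero    = ≡.subst (λ C → ColumnBasis (incidence 0) ([] ∷ []) C 1) (≡.sym (faces-addDisjointEdge G 0)) (ColumnBasis-vertices zero _)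
    basis (suc k) = ≡.subst₂ (λ R C → ColumnBasis (incidence (suc k)) R C (rank′ (suc k)))
                             (≡.sym (faces-addDisjointEdge G k)) (≡.sym (faces-addDisjointEdge G (suc k)))
                             (ColumnBasis-suspension (faces-unique G (suc k)) (removeAt-faces G (suc k)) (boundary-basis k))
    nFaces≡′ : ∀ i → nFaces (addDisjointEdge G) (suc i) ≡ entry (0 ∷ σ) i ℕ.+ rank′ i ℕ.+ rank′ (suc i)
    nFaces≡′ zero    = ≡.trans (≡.cong length (faces-addDisjointEdge G 0)) (≡.trans (length-suspension ([] ∷ []) (faces G 1))
                         (≡.cong suc (≡.trans (ℕₚ.+-comm 1 (nFaces G 1)) (≡.cong (nFaces G 1 ℕ.+_) (≡.sym rank-0)))))
    nFaces≡′ (suc i) = ≡.trans (≡.cong length (faces-addDisjointEdge G (suc i)))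
                         (≡.trans (length-suspension (faces G (suc i)) (faces G (suc (suc i))))
                                  (count (entry σ i) (rank i) (rank (suc i)) (nFaces≡ i)))
      where
      count : ∀ {f₁ f₂} e p q → f₁ ≡ e ℕ.+ p ℕ.+ q → f₁ ℕ.+ (f₁ ℕ.+ f₂) ≡ e ℕ.+ (f₁ ℕ.+ p) ℕ.+ (f₂ ℕ.+ q)
      count {f₁} {f₂} e p q f₁≡ = ≡.trans (≡.cong (ℕ._+ (f₁ ℕ.+ f₂)) f₁≡) (rearrange e p q f₁ f₂)
        where
        rearrange : ∀ e p q f₁ f₂ → e ℕ.+ p ℕ.+ q ℕ.+ (f₁ ℕ.+ f₂) ≡ e ℕ.+ (f₁ ℕ.+ p) ℕ.+ (f₂ ℕ.+ q)
        rearrange = solve-∀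

  Realisation : List ℕ → Set (c ⊔ ℓ)
  Realisation σ = Σ ℕ λ n → Σ (Graph n) λ G → RankData G σ

  addUniversalVertices : ∀ b {σ} → Realisation (0 ∷ σ) → Realisation (b ∷ σ)
  addUniversalVertices zero    R = R
  addUniversalVertices (suc b) R with addUniversalVertices b R
  ... | n , G , D = suc n , addUniversalVertex G , rankData-addUniversalVertex D

  realise : ∀ σ → Realisation σ
  realise []      = 1 , isolatedVertex , rankData-isolatedVertex
  realise (b ∷ σ) with realise σ
  ... | n , G , D = addUniversalVertices b (suc (suc n) , addDisjointEdge G , rankData-addDisjointEdge D)

mainTheorem13 : {c ℓ : Level} (F : Field c ℓ) (σ : List ℕ) →
    Σ ℕ (λ n → Σ (Graph n) (λ G → (i : ℕ) → ReducedBetti F G i (entry σ i)))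
mainTheorem13 F σ with Ranks.realise F σ
... | n , G , D = n , G , Ranks.RankData.reducedBetti D
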